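{- Let $q$ be a square prime power. Let $\mathcal{A}$ be the union of $s$ pairwise disjoint Baer subplanes of $\mathrm{PG}(2,q)$, $1\leq s\leq q-\sqrt{q}$, and let $P\notin\mathcal{A}$. Let $0\leq r\leq q-s$ and let $\ell_1,\ldots,\ell_r$ be distinct lines through $P$ each meeting $\mathcal{A}$ in exactly $s$ points. Let $\ell_{r+1}$ be a further line through $P$ that meets $\mathcal{A}$ in $s$ points (Option 1) or in $\sqrt{q}+s$ points (Option 2). Let $H\subseteq\ell_{r+1}\setminus\mathcal{A}$ be a set of $t$ points, where $0\leq t\leq q-s$ in Option 1 and $0\leq t\leq q-\sqrt{q}-s$ in Option 2, and let $\mathcal{S}=\mathcal{A}\cup\bigcup_{i=1}^{r}(\ell_i\setminus\{P\})\cup H$. Then $|\mathcal{S}|=s(q+\sqrt{q}+1)+r(q-s)+t$; every line different from $\ell_{r+1}$ meets $\mathcal{S}$ in at most $s+r+1$ or at least $s+\sqrt{q}$ points; and $\ell_{r+1}$ meets $\mathcal{S}$ in $s+t$ points (Option 1) or $s+\sqrt{q}+t$ points (Option 2).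
   Context: $\mathrm{PG}(2,q)$ is the desarguesian projective plane over $\mathrm{GF}(q)$. A Baer subplane is a subplane of order $\sqrt{q}$; it has $q+\sqrt{q}+1$ points and every line of $\mathrm{PG}(2,q)$ meets it in $1$ or $\sqrt{q}+1$ points. For a union of $s$ disjoint Baer subplanes and a point $P$ outside it, exactly $s$ lines through $P$ meet the union in $\sqrt{q}+s$ points and the other $q+1-s$ lines through $P$ meet it in $s$ points. -}

module Defs where

open import Data.Nat using (ℕ; zero; suc; _+_; _*_; _∸_; _≤_)
open import Data.Fin using (Fin)
open import Data.Fin.Properties using () renaming (_≟_ to _≟F_)
open import Data.Bool using (Bool; true; false; _∧_; _∨_; not) renaming (_≟_ to _≟B_)
open import Data.List using (List; []; _∷_; allFin; filter; length; concatMap; map)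
open import Data.Bool.ListAction using (any)
open import Data.Product using (Σ; _×_; _,_; ∃; ∃-syntax; proj₁)
open import Data.Sum using (_⊎_)
open import Relation.Nullary using (¬_; Dec; yes; no)
open import Relation.Nullary.Decidable using (does; _×-dec_; _⊎-dec_)
open import Relation.Binary.PropositionalEquality using (_≡_; _≢_; refl)
open import Algebra.Structures using (IsCommutativeRing)

-- Every finite field of order q is isomorphic to GF(q), so PG(2,q) built from
-- any such field is the desarguesian plane PG(2,q).
record FiniteField (q : ℕ) : Set where
  field
    _+F_ _*F_ : Fin q → Fin q → Fin q
    -F_       : Fin q → Fin q
    0F 1F     : Fin q
    isCommutativeRing : IsCommutativeRing _≡_ _+F_ _*F_ -F_ 0F 1F
    0≢1       : 0F ≢ 1F
    inverse   : ∀ x → x ≢ 0F → ∃[ y ] (x *F y ≡ 1F)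

module PG {q : ℕ} (F : FiniteField q) where
  open FiniteField F

  Triple : Set
  Triple = Fin q × Fin q × Fin q

  -- canonical representative of a nonzero vector up to scalars:
  -- the last nonzero coordinate equals 1
  Normalized : Triple → Set
  Normalized (x , y , z) =
    (z ≡ 1F) ⊎ ((z ≡ 0F × y ≡ 1F) ⊎ (z ≡ 0F × y ≡ 0F × x ≡ 1F))

  normalized? : (v : Triple) → Dec (Normalized v)
  normalized? (x , y , z) =
    (z ≟F 1F) ⊎-dec (((z ≟F 0F) ×-dec (y ≟F 1F))
                    ⊎-dec ((z ≟F 0F) ×-dec ((y ≟F 0F) ×-dec (x ≟F 1F))))

  -- points of PG(2,q): 1-dimensional subspaces of GF(q)^3 (canonical reps)
  Point : Set
  Point = Σ Triple Normalized

  -- lines of PG(2,q): 2-dimensional subspaces, given by their (canonical)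
  -- dual coordinates [a,b,c]; the line is {(x,y,z) : ax+by+cz = 0}
  Line : Set
  Line = Σ Triple Normalized

  allTriples : List Triple
  allTriples = concatMap (λ x → concatMap (λ y → map (λ z → (x , y , z)) (allFin q)) (allFin q)) (allFin q)

  normList : List Triple → List Point
  normList [] = []
  normList (v ∷ vs) with normalized? v
  ... | yes p = (v , p) ∷ normList vs
  ... | no _  = normList vs

  allPoints : List Point
  allPoints = normList allTriples

  allLines : List Line
  allLines = normList allTriples

  _∈L_ : Point → Line → Set
  ((x , y , z) , _) ∈L ((a , b , c) , _) = ((a *F x) +F (b *F y)) +F (c *F z) ≡ 0F

  _∈L?_ : (P : Point) (ℓ : Line) → Dec (P ∈L ℓ)
  ((x , y , z) , _) ∈L? ((a , b , c) , _) = (((a *F x) +F (b *F y)) +F (c *F z)) ≟F 0F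

  PointSet : Set
  PointSet = Point → Bool

  LineSet : Set
  LineSet = Line → Bool

  _∈_ : Point → PointSet → Set
  P ∈ S = S P ≡ true

  _∉_ : Point → PointSet → Set
  P ∉ S = S P ≡ false

  pointsOf : Line → PointSet
  pointsOf ℓ P = does (P ∈L? ℓ)

  _∪_ _∩_ : PointSet → PointSet → PointSet
  (S ∪ T) P = S P ∨ T P
  (S ∩ T) P = S P ∧ T P

  ⋃ : {n : ℕ} → (Fin n → PointSet) → PointSet
  ⋃ {n} B P = any (λ i → B i P) (allFin n)

  _minus_ : PointSet → Point → PointSet
  (S minus P) R = S R ∧ not (does (proj₁ R ≟T proj₁ P))
    where
      _≟T_ : (u v : Triple) → Dec (u ≡ v)
      (x , y , z) ≟T (x' , y' , z') with x ≟F x' | y ≟F y' | z ≟F z'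
      ... | yes refl | yes refl | yes refl = yes refl
      ... | no n | _ | _ = no λ { refl → n refl }
      ... | yes _ | no n | _ = no λ { refl → n refl }
      ... | yes _ | yes _ | no n = no λ { refl → n refl }

  ∣_∣ : PointSet → ℕ
  ∣ S ∣ = length (filter (λ P → S P ≟B true) allPoints)

  meet : Line → PointSet → ℕ
  meet ℓ S = ∣ pointsOf ℓ ∩ S ∣

  Collinear3 : Point → Point → Point → Set
  Collinear3 P Q R = ∃[ ℓ ] (P ∈L ℓ × Q ∈L ℓ × R ∈L ℓ)

  record IsSubplane (n : ℕ) (Bp : PointSet) (Bl : LineSet) : Set where
    field
      -- two distinct points of the subplane lie on a line of the subplane
      -- (unique, as it is unique already in PG(2,q))
      joinIn   : ∀ P Q → P ∈ Bp → Q ∈ Bp → P ≢ Q →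
                 ∃[ ℓ ] (Bl ℓ ≡ true × P ∈L ℓ × Q ∈L ℓ)
      meetIn   : ∀ ℓ m → Bl ℓ ≡ true → Bl m ≡ true → ℓ ≢ m →
                 ∃[ P ] (P ∈ Bp × P ∈L ℓ × P ∈L m)
      quadrangle : ∃[ P ] ∃[ Q ] ∃[ R ] ∃[ T ]
                 (P ∈ Bp × Q ∈ Bp × R ∈ Bp × T ∈ Bp ×
                  ¬ Collinear3 P Q R × ¬ Collinear3 P Q T ×
                  ¬ Collinear3 P R T × ¬ Collinear3 Q R T)
      order    : ∀ ℓ → Bl ℓ ≡ true → meet ℓ Bp ≡ suc n

  -- Baer subplane: subplane of order √q (here m with m * m = q)
  IsBaerSubplane : (m : ℕ) → PointSet → Set
  IsBaerSubplane m Bp = ∃[ Bl ] IsSubplane m Bp Bl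

-- Two distinct
-- lines have proportional common solutions (Cramer's rule), so they share at most one
-- point; counting the normalized solutions of ax + by + cz = 0 gives q + 1 points per
-- line, and double counting then shows that two points always lie on a common line.
--
-- Counting a subplane B of order m along the pencil through one of its points gives
-- |B| = m² + m + 1; counting it along the pencil through a point off B shows that, when
-- q = m², no line misses B, so every line meets B in 1 or m + 1 points.
--
-- For S, the Baer subplanes are disjoint and each ℓᵢ ∖ {P} adds its q − s points off them,
-- which gives |S|.  A line ℓᵢ carries at least q ≥ s + m points of S; a line meeting some Bᵢ
-- in two points carries at least (m + 1) + (s − 1) points of their union; any other line meets each Bᵢ,
-- each ℓᵢ and ℓ_{r+1} at most once, so it carries at most s + r + 1 points of S.

module Submission where

open import Defs
open import Data.Nat using (ℕ; suc; _+_; _*_; _∸_; _≤_)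
open import Data.Fin using (Fin)
open import Data.Product using (_×_)
open import Data.Sum using (_⊎_)
open import Relation.Binary.PropositionalEquality using (_≡_; _≢_)
open import Function.Definitions using (Injective)

open import Data.Nat using (zero; z≤n; s≤s; _≤?_)
open import Data.Nat.Properties
open import Data.Fin using (zero; suc)
open import Data.Fin.Properties using (any?) renaming (suc-injective to Fin-suc-injective; _≟_ to _≟F_)
open import Data.Bool using (Bool; true; false; _∧_; _∨_; not) renaming (_≟_ to _≟B_)
open import Data.Bool.Properties using (∧-conicalˡ; ∧-conicalʳ; ∧-idem; ∧-comm; ∧-distribˡ-∨; ∧-zeroʳ; ∨-zeroʳ)
open import Data.List using (List; []; _∷_; _++_; allFin; filter; length; concatMap; map; tabulate)
open import Data.Bool.ListAction using (any)
open import Data.Product using (_,_; ∃-syntax; proj₁; proj₂)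
open import Data.Sum using (inj₁; inj₂; [_,_]′)
open import Data.Empty using (⊥; ⊥-elim)
open import Relation.Nullary using (¬_; Dec; yes; no; does; _×-dec_)
open import Relation.Nullary.Decidable using (map′; dec-true; dec-false; does-⇔)
open import Relation.Binary.PropositionalEquality using (refl; sym; trans; cong; cong₂; subst; subst₂; module ≡-Reasoning)
open import Function using (_∘_; id)
open import Data.Nat.Tactic.RingSolver using (solve-∀)
open import Function.Bundles using (mk⇔)
open import Level using (0ℓ)
open import Algebra.Bundles using (CommutativeRing)
open import Algebra.Structures using (IsCommutativeRing)
open import Algebra.Properties.CommutativeSemigroup +-commutativeSemigroup using (interchange)

𝟙 : Bool → ℕ
𝟙 true  = 1
𝟙 false = 0

𝟙-∧ : ∀ a b → 𝟙 (a ∧ b) ≡ 𝟙 a * 𝟙 b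
𝟙-∧ true  b = sym (+-identityʳ (𝟙 b))
𝟙-∧ false b = refl

false≢true : false ≢ true
false≢true ()

does-true⇒ : ∀ {P : Set} (d : Dec P) → does d ≡ true → P
does-true⇒ (yes p) _ = p

𝟙-positive : ∀ {b} → 1 ≤ 𝟙 b → b ≡ true
𝟙-positive {true} _ = refl

𝟙-swap : ∀ a b c → 𝟙 a * 𝟙 (b ∧ c) ≡ 𝟙 c * 𝟙 (a ∧ b)
𝟙-swap true  true  c = trans (+-identityʳ _) (sym (*-identityʳ (𝟙 c)))
𝟙-swap true  false c = sym (*-zeroʳ (𝟙 c))
𝟙-swap false b     c = sym (*-zeroʳ (𝟙 c))

𝟙-mono : ∀ {a b} → (a ≡ true → b ≡ true) → 𝟙 a ≤ 𝟙 b
𝟙-mono {false} _   = z≤n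
𝟙-mono {true}  a⇒b = ≤-reflexive (cong 𝟙 (sym (a⇒b refl)))

𝟙-split : ∀ a e → (e ≡ true → a ≡ true) → 𝟙 a ≡ 𝟙 (a ∧ not e) + 𝟙 e
𝟙-split true  true  _   = refl
𝟙-split true  false _   = refl
𝟙-split false true  e⇒a = ⊥-elim (false≢true (e⇒a refl))
𝟙-split false false _   = refl

𝟙-partition : ∀ a e c → (e ≡ true → c ≡ false) → 𝟙 (a ∧ not e) ≡ 𝟙 (not c ∧ (a ∧ not e)) + 𝟙 (a ∧ c)
𝟙-partition true  true  true  e⇒¬c = ⊥-elim (false≢true (sym (e⇒¬c refl)))
𝟙-partition true  true  false _    = refl
𝟙-partition true  false true  _    = refl
𝟙-partition true  false false _    = refl
𝟙-partition false e     true  _    = refl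
𝟙-partition false e     false _    = refl

𝟙-∨-disjoint : ∀ a b c → (c ≡ true → a ∨ b ≡ false) → 𝟙 ((a ∨ b) ∨ c) ≡ 𝟙 a + 𝟙 (not a ∧ b) + 𝟙 c
𝟙-∨-disjoint true  b     true  apart = ⊥-elim (false≢true (sym (apart refl)))
𝟙-∨-disjoint true  b     false _     = refl
𝟙-∨-disjoint false true  true  apart = ⊥-elim (false≢true (sym (apart refl)))
𝟙-∨-disjoint false true  false _     = refl
𝟙-∨-disjoint false false c     _     = refl

𝟙-∨-≤ : ∀ a b → 𝟙 (a ∨ b) ≤ 𝟙 a + 𝟙 b
𝟙-∨-≤ true  b = s≤s z≤n
𝟙-∨-≤ false b = ≤-refl

module _ {A : Set} where

  sumBy : (A → ℕ) → List A → ℕ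
  sumBy f []       = 0
  sumBy f (x ∷ xs) = f x + sumBy f xs

  sumBy-cong : ∀ {f g : A → ℕ} xs → (∀ x → f x ≡ g x) → sumBy f xs ≡ sumBy g xs
  sumBy-cong []       f≗g = refl
  sumBy-cong (x ∷ xs) f≗g = cong₂ _+_ (f≗g x) (sumBy-cong xs f≗g)

  sumBy-mono : ∀ {f g : A → ℕ} xs → (∀ x → f x ≤ g x) → sumBy f xs ≤ sumBy g xs
  sumBy-mono []       f≤g = z≤n
  sumBy-mono (x ∷ xs) f≤g = +-mono-≤ (f≤g x) (sumBy-mono xs f≤g)

  sumBy-+ : ∀ (f g : A → ℕ) xs → sumBy (λ x → f x + g x) xs ≡ sumBy f xs + sumBy g xs
  sumBy-+ f g []       = refl
  sumBy-+ f g (x ∷ xs) =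
    trans (cong (f x + g x +_) (sumBy-+ f g xs)) (interchange (f x) (g x) _ _)

  sumBy-*ˡ : ∀ c (f : A → ℕ) xs → sumBy (λ x → c * f x) xs ≡ c * sumBy f xs
  sumBy-*ˡ c f []       = sym (*-zeroʳ c)
  sumBy-*ˡ c f (x ∷ xs) =
    trans (cong (c * f x +_) (sumBy-*ˡ c f xs)) (sym (*-distribˡ-+ c (f x) _))

  sumBy-zero : ∀ {f : A → ℕ} xs → (∀ x → f x ≡ 0) → sumBy f xs ≡ 0
  sumBy-zero []       f≗0 = refl
  sumBy-zero (x ∷ xs) f≗0 = cong₂ _+_ (f≗0 x) (sumBy-zero xs f≗0)

  sumBy-++ : ∀ (f : A → ℕ) xs ys → sumBy f (xs ++ ys) ≡ sumBy f xs + sumBy f ys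
  sumBy-++ f []       ys = refl
  sumBy-++ f (x ∷ xs) ys = trans (cong (f x +_) (sumBy-++ f xs ys)) (sym (+-assoc (f x) _ _))

  sumBy-positive : ∀ (f : A → ℕ) xs → 1 ≤ sumBy f xs → ∃[ x ] 1 ≤ f x
  sumBy-positive f (x ∷ xs) pos with f x in fx
  ... | suc _ = x , subst (1 ≤_) (sym fx) (s≤s z≤n)
  ... | zero  = sumBy-positive f xs pos

  length-filter : ∀ (T : A → Bool) xs →
                  length (filter (λ x → T x ≟B true) xs) ≡ sumBy (𝟙 ∘ T) xs
  length-filter T []       = refl
  length-filter T (x ∷ xs) with T x
  ... | true  = cong suc (length-filter T xs)
  ... | false = length-filter T xs

module _ {A B : Set} where

  sumBy-map : ∀ (f : B → ℕ) (g : A → B) xs → sumBy f (map g xs) ≡ sumBy (f ∘ g) xs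
  sumBy-map f g []       = refl
  sumBy-map f g (x ∷ xs) = cong (f (g x) +_) (sumBy-map f g xs)

  sumBy-concatMap : ∀ (f : B → ℕ) (g : A → List B) xs →
                    sumBy f (concatMap g xs) ≡ sumBy (sumBy f ∘ g) xs
  sumBy-concatMap f g []       = refl
  sumBy-concatMap f g (x ∷ xs) =
    trans (sumBy-++ f (g x) _) (cong (sumBy f (g x) +_) (sumBy-concatMap f g xs))

  sumBy-comm : ∀ (R : A → B → ℕ) xs ys →
               sumBy (λ x → sumBy (R x) ys) xs ≡ sumBy (λ y → sumBy (λ x → R x y) xs) ys
  sumBy-comm R []       ys = sym (sumBy-zero ys (λ _ → refl))
  sumBy-comm R (x ∷ xs) ys =
    trans (cong (sumBy (R x) ys +_) (sumBy-comm R xs ys))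
          (sym (sumBy-+ (R x) (λ y → sumBy (λ x → R x y) xs) ys))

sumFin : ∀ {n} → (Fin n → ℕ) → ℕ
sumFin {zero}  f = 0
sumFin {suc n} f = f zero + sumFin (f ∘ suc)

anyFin : ∀ {n} → (Fin n → Bool) → Bool
anyFin {zero}  g = false
anyFin {suc n} g = g zero ∨ anyFin (g ∘ suc)

module _ {A : Set} where

  sumBy-tabulate : ∀ {n} (f : A → ℕ) (g : Fin n → A) → sumBy f (tabulate g) ≡ sumFin (f ∘ g)
  sumBy-tabulate {zero}  f g = refl
  sumBy-tabulate {suc n} f g = cong (f (g zero) +_) (sumBy-tabulate f (g ∘ suc))

  any-tabulate : ∀ {n} (f : A → Bool) (g : Fin n → A) → any f (tabulate g) ≡ anyFin (f ∘ g)
  any-tabulate {zero}  f g = refl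
  any-tabulate {suc n} f g = cong (f (g zero) ∨_) (any-tabulate f (g ∘ suc))

sumBy-allFin : ∀ {n} (f : Fin n → ℕ) → sumBy f (allFin n) ≡ sumFin f
sumBy-allFin f = sumBy-tabulate f id

any-allFin : ∀ {n} (g : Fin n → Bool) → any g (allFin n) ≡ anyFin g
any-allFin g = any-tabulate g id

sumFin-cong : ∀ {n} {f g : Fin n → ℕ} → (∀ i → f i ≡ g i) → sumFin f ≡ sumFin g
sumFin-cong {zero}  f≗g = refl
sumFin-cong {suc n} f≗g = cong₂ _+_ (f≗g zero) (sumFin-cong (f≗g ∘ suc))

sumFin-mono : ∀ {n} {f g : Fin n → ℕ} → (∀ i → f i ≤ g i) → sumFin f ≤ sumFin g
sumFin-mono {zero}  f≤g = z≤n
sumFin-mono {suc n} f≤g = +-mono-≤ (f≤g zero) (sumFin-mono (f≤g ∘ suc))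

sumFin-const : ∀ {n} c → sumFin {n} (λ _ → c) ≡ n * c
sumFin-const {zero}  c = refl
sumFin-const {suc n} c = cong (c +_) (sumFin-const {n} c)

sumFin-zero : ∀ {n} {f : Fin n → ℕ} → (∀ i → f i ≡ 0) → sumFin f ≡ 0
sumFin-zero {zero}  f≗0 = refl
sumFin-zero {suc n} f≗0 = cong₂ _+_ (f≗0 zero) (sumFin-zero (f≗0 ∘ suc))

sumFin-+ : ∀ {n} (f g : Fin n → ℕ) → sumFin (λ i → f i + g i) ≡ sumFin f + sumFin g
sumFin-+ {zero}  f g = refl
sumFin-+ {suc n} f g =
  trans (cong (f zero + g zero +_) (sumFin-+ (f ∘ suc) (g ∘ suc))) (interchange (f zero) (g zero) _ _)

sumFin-*ˡ : ∀ {n} c (f : Fin n → ℕ) → sumFin (λ i → c * f i) ≡ c * sumFin f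
sumFin-*ˡ {zero}  c f = sym (*-zeroʳ c)
sumFin-*ˡ {suc n} c f =
  trans (cong (c * f zero +_) (sumFin-*ˡ c (f ∘ suc))) (sym (*-distribˡ-+ c (f zero) _))

sumFin-δ : ∀ {n} (i₀ : Fin n) (f : Fin n → ℕ) →
           sumFin (λ i → 𝟙 (does (i ≟F i₀)) * f i) ≡ f i₀
sumFin-δ {suc n} zero f =
  trans (cong₂ _+_ (+-identityʳ (f zero)) (sumFin-zero {n} (λ _ → refl))) (+-identityʳ (f zero))
sumFin-δ {suc n} (suc i₀) f = sumFin-δ i₀ (f ∘ suc)

sumFin-sumBy-comm : ∀ {A : Set} {n} (R : Fin n → A → ℕ) xs →
                    sumFin (λ i → sumBy (R i) xs) ≡ sumBy (λ x → sumFin (λ i → R i x)) xs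
sumFin-sumBy-comm {n = zero}  R xs = sym (sumBy-zero xs (λ _ → refl))
sumFin-sumBy-comm {n = suc n} R xs =
  trans (cong (sumBy (R zero) xs +_) (sumFin-sumBy-comm (R ∘ suc) xs))
        (sym (sumBy-+ (R zero) (λ x → sumFin (λ i → R (suc i) x)) xs))

𝟙-anyFin-disjoint : ∀ {n} (g : Fin n → Bool) → (∀ i j → i ≢ j → g i ≡ true → g j ≡ false) →
                    𝟙 (anyFin g) ≡ sumFin (𝟙 ∘ g)
𝟙-anyFin-disjoint {zero}  g disjoint = refl
𝟙-anyFin-disjoint {suc n} g disjoint with g zero in g₀
... | false = 𝟙-anyFin-disjoint (g ∘ suc) (λ i j i≢j → disjoint (suc i) (suc j) (i≢j ∘ Fin-suc-injective))
... | true  = cong suc (sym (sumFin-zero {n} (λ i → cong 𝟙 (disjoint zero (suc i) (λ ()) g₀))))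

𝟙-anyFin-≤ : ∀ {n} (g : Fin n → Bool) → 𝟙 (anyFin g) ≤ sumFin (𝟙 ∘ g)
𝟙-anyFin-≤ {zero}  g = z≤n
𝟙-anyFin-≤ {suc n} g with g zero
... | true  = s≤s z≤n
... | false = 𝟙-anyFin-≤ (g ∘ suc)

anyFin-intro : ∀ {n} (g : Fin n → Bool) i → g i ≡ true → anyFin g ≡ true
anyFin-intro g zero    gi rewrite gi = refl
anyFin-intro g (suc i) gi with g zero
... | true  = refl
... | false = anyFin-intro (g ∘ suc) i gi

anyFin-const-false : ∀ {n} → anyFin {n} (λ _ → false) ≡ false
anyFin-const-false {zero}  = refl
anyFin-const-false {suc n} = anyFin-const-false {n}

∧-anyFin : ∀ a {n} (g : Fin n → Bool) → a ∧ anyFin g ≡ anyFin (λ i → a ∧ g i)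
∧-anyFin true  g = refl
∧-anyFin false {n} g = sym (anyFin-const-false {n})

anyFin-witness : ∀ {n} (g : Fin n → Bool) → anyFin g ≡ true → ∃[ i ] g i ≡ true
anyFin-witness {suc n} g any≡true with g zero in g₀
... | true  = zero , g₀
... | false = let (i , gi) = anyFin-witness (g ∘ suc) any≡true in suc i , gi

module FieldArithmetic {q : ℕ} (F : FiniteField q) where

  open FiniteField F
  open IsCommutativeRing isCommutativeRing using () renaming
    (+-assoc to +ᶠ-assoc; +-identityˡ to +ᶠ-identityˡ; +-identityʳ to +ᶠ-identityʳ;
     -‿inverseˡ to -ᶠ‿inverseˡ; *-assoc to *ᶠ-assoc; *-comm to *ᶠ-comm;
     *-identityˡ to *ᶠ-identityˡ; *-identityʳ to *ᶠ-identityʳ; zeroˡ to *ᶠ-zeroˡ; zeroʳ to *ᶠ-zeroʳ)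
    public

  field-ring : CommutativeRing 0ℓ 0ℓ
  field-ring = record { isCommutativeRing = isCommutativeRing }

  open import Algebra.Properties.Ring (CommutativeRing.ring field-ring) public
    using () renaming (+-cancelʳ to +ᶠ-cancelʳ)
  open import Algebra.Solver.Ring.NaturalCoefficients.Default
    (CommutativeRing.commutativeSemiring field-ring) public

  infixl 6 _+ᶠ_
  infixl 7 _*ᶠ_

  _+ᶠ_ _*ᶠ_ : Fin q → Fin q → Fin q
  _+ᶠ_ = _+F_
  _*ᶠ_ = _*F_

  1≢0 : 1F ≢ 0F
  1≢0 = 0≢1 ∘ sym

  *ᶠ-cancelˡ : ∀ {u a b} → u ≢ 0F → u *ᶠ a ≡ u *ᶠ b → a ≡ b
  *ᶠ-cancelˡ {u} {a} {b} u≢0 ua≡ub with inverse u u≢0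
  ... | v , uv≡1 = begin
    a              ≡⟨ sym (*ᶠ-identityˡ a) ⟩
    1F *ᶠ a        ≡⟨ cong (_*ᶠ a) (trans (sym uv≡1) (*ᶠ-comm u v)) ⟩
    v *ᶠ u *ᶠ a    ≡⟨ *ᶠ-assoc v u a ⟩
    v *ᶠ (u *ᶠ a)  ≡⟨ cong (v *ᶠ_) ua≡ub ⟩
    v *ᶠ (u *ᶠ b)  ≡⟨ sym (*ᶠ-assoc v u b) ⟩
    v *ᶠ u *ᶠ b    ≡⟨ cong (_*ᶠ b) (trans (*ᶠ-comm v u) uv≡1) ⟩
    1F *ᶠ b        ≡⟨ *ᶠ-identityˡ b ⟩
    b              ∎
    where open ≡-Reasoning

  *ᶠ-nonzero : ∀ {u a} → u ≢ 0F → a ≢ 0F → u *ᶠ a ≢ 0F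
  *ᶠ-nonzero {u} {a} u≢0 a≢0 ua≡0 = a≢0 (*ᶠ-cancelˡ u≢0 (trans ua≡0 (sym (*ᶠ-zeroʳ u))))

  difference-split : ∀ a b → a ≡ (a +ᶠ -F b) +ᶠ b
  difference-split a b =
    sym (trans (+ᶠ-assoc a (-F b) b) (trans (cong (a +ᶠ_) (-ᶠ‿inverseˡ b)) (+ᶠ-identityʳ a)))

  -- The hypothesis is (a − b)(D − D') = 0 written without subtraction.
  cross-cancel : ∀ {a b D D'} → a *ᶠ D +ᶠ b *ᶠ D' ≡ a *ᶠ D' +ᶠ b *ᶠ D → D ≢ D' → a ≡ b
  cross-cancel {a} {b} {D} {D'} eq D≢D' with a +ᶠ -F b ≟F 0F
  ... | yes e≡0 = trans (difference-split a b) (trans (cong (_+ᶠ b) e≡0) (+ᶠ-identityˡ b))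
  ... | no  e≢0 = ⊥-elim (D≢D' (*ᶠ-cancelˡ e≢0 (+ᶠ-cancelʳ (b *ᶠ D +ᶠ b *ᶠ D') _ _ balanced)))
    where
    e = a +ᶠ -F b
    balanced : e *ᶠ D +ᶠ (b *ᶠ D +ᶠ b *ᶠ D') ≡ e *ᶠ D' +ᶠ (b *ᶠ D +ᶠ b *ᶠ D')
    balanced = begin
      e *ᶠ D +ᶠ (b *ᶠ D +ᶠ b *ᶠ D')   ≡⟨ solve 4 (λ e b D D' → e :* D :+ (b :* D :+ b :* D') := (e :+ b) :* D :+ b :* D') refl e b D D' ⟩
      (e +ᶠ b) *ᶠ D +ᶠ b *ᶠ D'        ≡⟨ cong (λ t → t *ᶠ D +ᶠ b *ᶠ D') (sym (difference-split a b)) ⟩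
      a *ᶠ D +ᶠ b *ᶠ D'               ≡⟨ eq ⟩
      a *ᶠ D' +ᶠ b *ᶠ D               ≡⟨ cong (λ t → t *ᶠ D' +ᶠ b *ᶠ D) (difference-split a b) ⟩
      (e +ᶠ b) *ᶠ D' +ᶠ b *ᶠ D        ≡⟨ solve 4 (λ e b D D' → (e :+ b) :* D' :+ b :* D := e :* D' :+ (b :* D :+ b :* D')) refl e b D D' ⟩
      e *ᶠ D' +ᶠ (b *ᶠ D +ᶠ b *ᶠ D')  ∎
      where open ≡-Reasoning

  slope-zero : ∀ {a c D D' A A'} → a *ᶠ D +ᶠ c *ᶠ A ≡ a *ᶠ D' +ᶠ c *ᶠ A' → c ≡ 0F → D ≢ D' → a ≡ 0F
  slope-zero {a} {c} {D} {D'} {A} {A'} eq refl = cross-cancel (begin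
    a *ᶠ D +ᶠ 0F *ᶠ D'   ≡⟨ cong (a *ᶠ D +ᶠ_) (trans (*ᶠ-zeroˡ D') (sym (*ᶠ-zeroˡ A))) ⟩
    a *ᶠ D +ᶠ 0F *ᶠ A    ≡⟨ eq ⟩
    a *ᶠ D' +ᶠ 0F *ᶠ A'  ≡⟨ cong (a *ᶠ D' +ᶠ_) (trans (*ᶠ-zeroˡ A') (sym (*ᶠ-zeroˡ D))) ⟩
    a *ᶠ D' +ᶠ 0F *ᶠ D   ∎)
    where open ≡-Reasoning

  proportional : ∀ {a b c d D D' A A'} →
                 a *ᶠ D +ᶠ c *ᶠ A ≡ a *ᶠ D' +ᶠ c *ᶠ A' → b *ᶠ D +ᶠ d *ᶠ A ≡ b *ᶠ D' +ᶠ d *ᶠ A' →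
                 D ≢ D' → a *ᶠ d ≡ c *ᶠ b
  proportional {a} {b} {c} {d} {D} {D'} {A} {A'} eq₁ eq₂ = cross-cancel (+ᶠ-cancelʳ (K +ᶠ K') _ _ summed)
    where
    K  = c *ᶠ d *ᶠ A
    K' = c *ᶠ d *ᶠ A'
    summed : a *ᶠ d *ᶠ D +ᶠ c *ᶠ b *ᶠ D' +ᶠ (K +ᶠ K') ≡ a *ᶠ d *ᶠ D' +ᶠ c *ᶠ b *ᶠ D +ᶠ (K +ᶠ K')
    summed = begin
      a *ᶠ d *ᶠ D +ᶠ c *ᶠ b *ᶠ D' +ᶠ (K +ᶠ K')
        ≡⟨ solve 8 (λ a b c d D D' A A' → a :* d :* D :+ c :* b :* D' :+ (c :* d :* A :+ c :* d :* A')
                    := d :* (a :* D :+ c :* A) :+ c :* (b :* D' :+ d :* A')) refl a b c d D D' A A' ⟩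
      d *ᶠ (a *ᶠ D +ᶠ c *ᶠ A) +ᶠ c *ᶠ (b *ᶠ D' +ᶠ d *ᶠ A')
        ≡⟨ cong₂ (λ s t → d *ᶠ s +ᶠ c *ᶠ t) eq₁ (sym eq₂) ⟩
      d *ᶠ (a *ᶠ D' +ᶠ c *ᶠ A') +ᶠ c *ᶠ (b *ᶠ D +ᶠ d *ᶠ A)
        ≡⟨ solve 8 (λ a b c d D D' A A' → d :* (a :* D' :+ c :* A') :+ c :* (b :* D :+ d :* A)
                    := a :* d :* D' :+ c :* b :* D :+ (c :* d :* A :+ c :* d :* A')) refl a b c d D D' A A' ⟩
      a *ᶠ d *ᶠ D' +ᶠ c *ᶠ b *ᶠ D +ᶠ (K +ᶠ K')  ∎
      where open ≡-Reasoning

module Incidence {q : ℕ} (F : FiniteField q) where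

  open FiniteField F
  open FieldArithmetic F
  open PG F

  infix 8 _·_
  _·_ : Triple → Triple → Fin q
  (a , b , c) · (x , y , z) = a *ᶠ x +ᶠ b *ᶠ y +ᶠ c *ᶠ z

  Parallel : Triple → Triple → Set
  Parallel (u₁ , u₂ , u₃) (v₁ , v₂ , v₃) =
    u₂ *ᶠ v₃ ≡ u₃ *ᶠ v₂ × u₃ *ᶠ v₁ ≡ u₁ *ᶠ v₃ × u₁ *ᶠ v₂ ≡ u₂ *ᶠ v₁

  Nonzero : Triple → Set
  Nonzero (x , y , z) = x ≡ 0F → y ≡ 0F → z ≡ 0F → ⊥

  rotate : Triple → Triple
  rotate (a , b , c) = (b , c , a)

  ·-rotate : ∀ u v → rotate u · rotate v ≡ u · v
  ·-rotate (a , b , c) (x , y , z) =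
    solve 6 (λ a b c x y z → b :* y :+ c :* z :+ a :* x := a :* x :+ b :* y :+ c :* z) refl a b c x y z

  Parallel-unrotate : ∀ u v → Parallel (rotate u) (rotate v) → Parallel u v
  Parallel-unrotate _ _ (e₁ , e₂ , e₃) = e₃ , e₁ , e₂

  Nonzero-rotate : ∀ u → Nonzero u → Nonzero (rotate u)
  Nonzero-rotate _ u≢0 y≡0 z≡0 x≡0 = u≢0 x≡0 y≡0 z≡0

  normalized⇒nonzero : ∀ u → Normalized u → Nonzero u
  normalized⇒nonzero _ (inj₁ z≡1)               _   _   z≡0 = 0≢1 (trans (sym z≡0) z≡1)
  normalized⇒nonzero _ (inj₂ (inj₁ (_ , y≡1)))     _   y≡0 _   = 0≢1 (trans (sym y≡0) y≡1)
  normalized⇒nonzero _ (inj₂ (inj₂ (_ , _ , x≡1))) x≡0 _   _   = 0≢1 (trans (sym x≡0) x≡1)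

  normalized-parallel⇒≡ : ∀ u v → Normalized u → Normalized v → Parallel u v → u ≡ v
  normalized-parallel⇒≡ (a , b , _) (c , d , _) (inj₁ refl) (inj₁ refl) (e₁ , e₂ , _) =
    cong₂ (λ x y → (x , y , 1F)) (trans (sym (*ᶠ-identityʳ a)) (trans (sym e₂) (*ᶠ-identityˡ c)))
                                 (trans (sym (*ᶠ-identityʳ b)) (trans e₁ (*ᶠ-identityˡ d)))
  normalized-parallel⇒≡ (a , b , _) _ (inj₁ refl) (inj₂ (inj₁ (refl , refl))) (e₁ , _ , _) =
    ⊥-elim (0≢1 (trans (sym (*ᶠ-zeroʳ b)) (trans e₁ (*ᶠ-identityˡ 1F))))
  normalized-parallel⇒≡ (a , _ , _) _ (inj₁ refl) (inj₂ (inj₂ (refl , refl , refl))) (_ , e₂ , _) =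
    ⊥-elim (0≢1 (trans (sym (*ᶠ-zeroʳ a)) (trans (sym e₂) (*ᶠ-identityˡ 1F))))
  normalized-parallel⇒≡ _ (_ , d , _) (inj₂ (inj₁ (refl , refl))) (inj₁ refl) (e₁ , _ , _) =
    ⊥-elim (0≢1 (trans (sym (*ᶠ-zeroˡ d)) (trans (sym e₁) (*ᶠ-identityˡ 1F))))
  normalized-parallel⇒≡ (a , _ , _) (c , _ , _) (inj₂ (inj₁ (refl , refl))) (inj₂ (inj₁ (refl , refl))) (_ , _ , e₃) =
    cong (λ x → (x , 1F , 0F)) (trans (sym (*ᶠ-identityʳ a)) (trans e₃ (*ᶠ-identityˡ c)))
  normalized-parallel⇒≡ (a , _ , _) _ (inj₂ (inj₁ (refl , refl))) (inj₂ (inj₂ (refl , refl , refl))) (_ , _ , e₃) =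
    ⊥-elim (0≢1 (trans (sym (*ᶠ-zeroʳ a)) (trans e₃ (*ᶠ-identityˡ 1F))))
  normalized-parallel⇒≡ _ (c , _ , _) (inj₂ (inj₂ (refl , refl , refl))) (inj₁ refl) (_ , e₂ , _) =
    ⊥-elim (0≢1 (trans (sym (*ᶠ-zeroˡ c)) (trans e₂ (*ᶠ-identityˡ 1F))))
  normalized-parallel⇒≡ _ (c , _ , _) (inj₂ (inj₂ (refl , refl , refl))) (inj₂ (inj₁ (refl , refl))) (_ , _ , e₃) =
    ⊥-elim (0≢1 (trans (sym (*ᶠ-zeroˡ c)) (trans (sym e₃) (*ᶠ-identityˡ 1F))))
  normalized-parallel⇒≡ _ _ (inj₂ (inj₂ (refl , refl , refl))) (inj₂ (inj₂ (refl , refl , refl))) _ = refl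

  KernelParallel : Triple → Triple → Set
  KernelParallel l n = ∀ {x y} → l · x ≡ 0F → n · x ≡ 0F → l · y ≡ 0F → n · y ≡ 0F →
                       Nonzero x → Nonzero y → Parallel x y

  private
    vanish : ∀ a {s} R → s ≡ 0F → a *ᶠ s +ᶠ R ≡ R
    vanish a R refl = trans (cong (_+ᶠ R) (*ᶠ-zeroʳ a)) (+ᶠ-identityˡ R)

  module _ {l₁ l₂ l₃ n₁ n₂ n₃ : Fin q} where

    private
      l = (l₁ , l₂ , l₃)
      n = (n₁ , n₂ , n₃)

    eliminate-x₂ : ∀ {x₁ x₂ x₃} → l · (x₁ , x₂ , x₃) ≡ 0F → n · (x₁ , x₂ , x₃) ≡ 0F →
                   x₁ *ᶠ (l₁ *ᶠ n₂) +ᶠ x₃ *ᶠ (l₃ *ᶠ n₂) ≡ x₁ *ᶠ (l₂ *ᶠ n₁) +ᶠ x₃ *ᶠ (l₂ *ᶠ n₃)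
    eliminate-x₂ {x₁} {x₂} {x₃} lx nx = trans (sym (vanish l₂ _ nx)) (trans identity (vanish n₂ _ lx))
      where
      identity : l₂ *ᶠ n · (x₁ , x₂ , x₃) +ᶠ (x₁ *ᶠ (l₁ *ᶠ n₂) +ᶠ x₃ *ᶠ (l₃ *ᶠ n₂))
               ≡ n₂ *ᶠ l · (x₁ , x₂ , x₃) +ᶠ (x₁ *ᶠ (l₂ *ᶠ n₁) +ᶠ x₃ *ᶠ (l₂ *ᶠ n₃))
      identity = solve 9 (λ l₁ l₂ l₃ n₁ n₂ n₃ x₁ x₂ x₃ →
          l₂ :* (n₁ :* x₁ :+ n₂ :* x₂ :+ n₃ :* x₃) :+ (x₁ :* (l₁ :* n₂) :+ x₃ :* (l₃ :* n₂))
        := n₂ :* (l₁ :* x₁ :+ l₂ :* x₂ :+ l₃ :* x₃) :+ (x₁ :* (l₂ :* n₁) :+ x₃ :* (l₂ :* n₃)))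
        refl l₁ l₂ l₃ n₁ n₂ n₃ x₁ x₂ x₃

    eliminate-x₁ : ∀ {x₁ x₂ x₃} → l · (x₁ , x₂ , x₃) ≡ 0F → n · (x₁ , x₂ , x₃) ≡ 0F →
                   x₂ *ᶠ (l₂ *ᶠ n₁) +ᶠ x₃ *ᶠ (l₃ *ᶠ n₁) ≡ x₂ *ᶠ (l₁ *ᶠ n₂) +ᶠ x₃ *ᶠ (l₁ *ᶠ n₃)
    eliminate-x₁ {x₁} {x₂} {x₃} lx nx = trans (sym (vanish l₁ _ nx)) (trans identity (vanish n₁ _ lx))
      where
      identity : l₁ *ᶠ n · (x₁ , x₂ , x₃) +ᶠ (x₂ *ᶠ (l₂ *ᶠ n₁) +ᶠ x₃ *ᶠ (l₃ *ᶠ n₁))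
               ≡ n₁ *ᶠ l · (x₁ , x₂ , x₃) +ᶠ (x₂ *ᶠ (l₁ *ᶠ n₂) +ᶠ x₃ *ᶠ (l₁ *ᶠ n₃))
      identity = solve 9 (λ l₁ l₂ l₃ n₁ n₂ n₃ x₁ x₂ x₃ →
          l₁ :* (n₁ :* x₁ :+ n₂ :* x₂ :+ n₃ :* x₃) :+ (x₂ :* (l₂ :* n₁) :+ x₃ :* (l₃ :* n₁))
        := n₁ :* (l₁ :* x₁ :+ l₂ :* x₂ :+ l₃ :* x₃) :+ (x₂ :* (l₁ :* n₂) :+ x₃ :* (l₁ :* n₃)))
        refl l₁ l₂ l₃ n₁ n₂ n₃ x₁ x₂ x₃

    -- Cramer's rule: a nonzero minor fixes the ratios x₁ : x₃ and x₂ : x₃ of a common solution.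
    kernel-parallel : l₁ *ᶠ n₂ ≢ l₂ *ᶠ n₁ → KernelParallel l n
    kernel-parallel minor≢0 {x₁ , x₂ , x₃} {y₁ , y₂ , y₃} lx nx ly ny x≢0 y≢0 =
      x₂y₃≡x₃y₂ , sym x₁y₃≡x₃y₁ , x₁y₂≡x₂y₁
      where
      x₂y₃≡x₃y₂ : x₂ *ᶠ y₃ ≡ x₃ *ᶠ y₂
      x₂y₃≡x₃y₂ = proportional (eliminate-x₁ lx nx) (eliminate-x₁ ly ny) (minor≢0 ∘ sym)
      x₁y₃≡x₃y₁ : x₁ *ᶠ y₃ ≡ x₃ *ᶠ y₁
      x₁y₃≡x₃y₁ = proportional (eliminate-x₂ lx nx) (eliminate-x₂ ly ny) minor≢0
      third≢0 : ∀ {z₁ z₂ z₃} → l · (z₁ , z₂ , z₃) ≡ 0F → n · (z₁ , z₂ , z₃) ≡ 0F →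
                Nonzero (z₁ , z₂ , z₃) → z₃ ≢ 0F
      third≢0 lz nz z≢0 z₃≡0 =
        z≢0 (slope-zero (eliminate-x₂ lz nz) z₃≡0 minor≢0) (slope-zero (eliminate-x₁ lz nz) z₃≡0 (minor≢0 ∘ sym)) z₃≡0
      x₁y₂≡x₂y₁ : x₁ *ᶠ y₂ ≡ x₂ *ᶠ y₁
      x₁y₂≡x₂y₁ = *ᶠ-cancelˡ (*ᶠ-nonzero (third≢0 lx nx x≢0) (third≢0 ly ny y≢0)) (begin
        x₃ *ᶠ y₃ *ᶠ (x₁ *ᶠ y₂)     ≡⟨ solve 4 (λ x₁ x₃ y₂ y₃ → x₃ :* y₃ :* (x₁ :* y₂) := x₁ :* y₃ :* (x₃ :* y₂)) refl x₁ x₃ y₂ y₃ ⟩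
        x₁ *ᶠ y₃ *ᶠ (x₃ *ᶠ y₂)     ≡⟨ cong₂ _*ᶠ_ x₁y₃≡x₃y₁ (sym x₂y₃≡x₃y₂) ⟩
        x₃ *ᶠ y₁ *ᶠ (x₂ *ᶠ y₃)     ≡⟨ solve 4 (λ x₂ x₃ y₁ y₃ → x₃ :* y₁ :* (x₂ :* y₃) := x₃ :* y₃ :* (x₂ :* y₁)) refl x₂ x₃ y₁ y₃ ⟩
        x₃ *ᶠ y₃ *ᶠ (x₂ *ᶠ y₁)     ∎)
        where open ≡-Reasoning

  kernel-parallel-rotate : ∀ l n → KernelParallel (rotate l) (rotate n) → KernelParallel l n
  kernel-parallel-rotate l n kp {x} {y} lx nx ly ny x≢0 y≢0 =
    Parallel-unrotate x y (kp (trans (·-rotate l x) lx) (trans (·-rotate n x) nx)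
                              (trans (·-rotate l y) ly) (trans (·-rotate n y) ny)
                              (Nonzero-rotate x x≢0) (Nonzero-rotate y y≢0))

  common-kernel-parallel : ∀ l n → ¬ Parallel l n → KernelParallel l n
  common-kernel-parallel l@(l₁ , l₂ , l₃) n@(n₁ , n₂ , n₃) ¬l∥n
    with l₁ *ᶠ n₂ ≟F l₂ *ᶠ n₁ | l₂ *ᶠ n₃ ≟F l₃ *ᶠ n₂ | l₃ *ᶠ n₁ ≟F l₁ *ᶠ n₃
  ... | no minor≢0 | _ | _ = kernel-parallel minor≢0
  ... | yes _ | no minor≢0 | _ = kernel-parallel-rotate l n (kernel-parallel minor≢0)
  ... | yes _ | yes _ | no minor≢0 =
    kernel-parallel-rotate l n (kernel-parallel-rotate (rotate l) (rotate n) (kernel-parallel minor≢0))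
  ... | yes e₃ | yes e₁ | yes e₂ = ⊥-elim (¬l∥n (e₁ , e₂ , e₃))

  Normalized-irrelevant : ∀ u (p p' : Normalized u) → p ≡ p'
  Normalized-irrelevant _ (inj₁ refl) (inj₁ refl) = refl
  Normalized-irrelevant _ (inj₁ refl) (inj₂ (inj₁ (z≡0 , _)))     = ⊥-elim (0≢1 (sym z≡0))
  Normalized-irrelevant _ (inj₁ refl) (inj₂ (inj₂ (z≡0 , _)))     = ⊥-elim (0≢1 (sym z≡0))
  Normalized-irrelevant _ (inj₂ (inj₁ (z≡0 , _))) (inj₁ refl)     = ⊥-elim (0≢1 (sym z≡0))
  Normalized-irrelevant _ (inj₂ (inj₂ (z≡0 , _))) (inj₁ refl)     = ⊥-elim (0≢1 (sym z≡0))
  Normalized-irrelevant _ (inj₂ (inj₁ (refl , refl))) (inj₂ (inj₁ (refl , refl))) = refl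
  Normalized-irrelevant _ (inj₂ (inj₁ (refl , refl))) (inj₂ (inj₂ (_ , y≡0 , _))) = ⊥-elim (0≢1 (sym y≡0))
  Normalized-irrelevant _ (inj₂ (inj₂ (_ , y≡0 , _))) (inj₂ (inj₁ (refl , refl))) = ⊥-elim (0≢1 (sym y≡0))
  Normalized-irrelevant _ (inj₂ (inj₂ (refl , refl , refl))) (inj₂ (inj₂ (refl , refl , refl))) = refl

  point-≡ : ∀ (X Y : Point) → proj₁ X ≡ proj₁ Y → X ≡ Y
  point-≡ (u , p) (.u , p') refl = cong (u ,_) (Normalized-irrelevant u p p')

  -- Built with ×-dec rather than ≡-dec so that does (X ≟P Y) computes to a conjunction of
  -- coordinate tests, which ∑P-δ relies on.
  _≟T_ : (u v : Triple) → Dec (u ≡ v)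
  (x , y , z) ≟T (a , b , c) =
    map′ (λ { (refl , refl , refl) → refl }) (λ { refl → refl , refl , refl })
         (x ≟F a ×-dec (y ≟F b ×-dec z ≟F c))

  _≟P_ : (X Y : Point) → Dec (X ≡ Y)
  X ≟P Y = map′ (point-≡ X Y) (cong proj₁) (proj₁ X ≟T proj₁ Y)

  parallel⇒≡ : ∀ (X Y : Point) → Parallel (proj₁ X) (proj₁ Y) → X ≡ Y
  parallel⇒≡ X Y X∥Y = point-≡ X Y (normalized-parallel⇒≡ _ _ (proj₂ X) (proj₂ Y) X∥Y)

  two-points-two-lines : ∀ X Y l n → X ∈L l → Y ∈L l → X ∈L n → Y ∈L n → X ≡ Y ⊎ l ≡ n
  two-points-two-lines X Y l n Xl Yl Xn Yn with l ≟P n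
  ... | yes l≡n = inj₂ l≡n
  ... | no  l≢n = inj₁ (parallel⇒≡ X Y
        (common-kernel-parallel (proj₁ l) (proj₁ n) (l≢n ∘ parallel⇒≡ l n) Xl Xn Yl Yn
          (normalized⇒nonzero _ (proj₂ X)) (normalized⇒nonzero _ (proj₂ Y))))

  unique-line : ∀ {X Y l n} → X ≢ Y → X ∈L l → Y ∈L l → X ∈L n → Y ∈L n → l ≡ n
  unique-line X≢Y Xl Yl Xn Yn = [ ⊥-elim ∘ X≢Y , id ]′ (two-points-two-lines _ _ _ _ Xl Yl Xn Yn)

  unique-meet : ∀ {X Y l n} → l ≢ n → X ∈L l → Y ∈L l → X ∈L n → Y ∈L n → X ≡ Y
  unique-meet l≢n Xl Yl Xn Yn = [ id , ⊥-elim ∘ l≢n ]′ (two-points-two-lines _ _ _ _ Xl Yl Xn Yn)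

module Counting {q : ℕ} (F : FiniteField q) where

  open FiniteField F
  open FieldArithmetic F
  open PG F
  open Incidence F

  -- Lines are normalized triples as well (allLines = allPoints), so ∑P and # also range over lines.
  ∑P : (Point → ℕ) → ℕ
  ∑P f = sumBy f allPoints

  #_ : (Point → Bool) → ℕ
  # T = ∑P (𝟙 ∘ T)

  ∣∣≡# : ∀ S → ∣ S ∣ ≡ # S
  ∣∣≡# S = length-filter S allPoints

  meet≡# : ∀ l S → meet l S ≡ # (pointsOf l ∩ S)
  meet≡# l S = length-filter (pointsOf l ∩ S) allPoints

  δ : Fin q → Fin q → ℕ
  δ a b = 𝟙 (does (a ≟F b))

  δ-split : ∀ a b c (f : Fin q → ℕ) → sumFin (λ i → (δ i a + δ i b * c) * f i) ≡ f a + c * f b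
  δ-split a b c f = begin
    sumFin (λ i → (δ i a + δ i b * c) * f i)       ≡⟨ sumFin-cong (λ i → distribute (δ i a) (δ i b)) ⟩
    sumFin (λ i → δ i a * f i + δ i b * (c * f i)) ≡⟨ sumFin-+ (λ i → δ i a * f i) (λ i → δ i b * (c * f i)) ⟩
    sumFin (λ i → δ i a * f i) + sumFin (λ i → δ i b * (c * f i))
                                                   ≡⟨ cong₂ _+_ (sumFin-δ a f) (sumFin-δ b (λ i → c * f i)) ⟩
    f a + c * f b                                  ∎
    where
    open ≡-Reasoning
    distribute : ∀ {i} x y → (x + y * c) * f i ≡ x * f i + y * (c * f i)
    distribute {i} x y = trans (*-distribʳ-+ (f i) x (y * c)) (cong (x * f i +_) (*-assoc y c (f i)))

  isNormalized : Triple → ℕ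
  isNormalized u = 𝟙 (does (normalized? u))

  isNormalized-δ : ∀ x y z → isNormalized (x , y , z) ≡ δ z 1F + δ z 0F * (δ y 1F + δ y 0F * δ x 1F)
  isNormalized-δ x y z = shape (does (z ≟F 1F)) (does (z ≟F 0F)) (does (y ≟F 1F)) (does (y ≟F 0F)) (does (x ≟F 1F))
                               (exclusive z) (exclusive y)
    where
    exclusive : ∀ w → does (w ≟F 1F) ≡ true → does (w ≟F 0F) ≡ false
    exclusive w w≟1 with w ≟F 1F
    exclusive w _  | yes refl = dec-false (1F ≟F 0F) 1≢0
    exclusive w () | no _
    shape : ∀ z₁ z₀ y₁ y₀ x₁ → (z₁ ≡ true → z₀ ≡ false) → (y₁ ≡ true → y₀ ≡ false) →
            𝟙 (z₁ ∨ ((z₀ ∧ y₁) ∨ (z₀ ∧ (y₀ ∧ x₁)))) ≡ 𝟙 z₁ + 𝟙 z₀ * (𝟙 y₁ + 𝟙 y₀ * 𝟙 x₁)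
    shape true  _     _     _     _     excl _ rewrite excl refl = refl
    shape false false _     _     _     _    _ = refl
    shape false true  true  _     _     _    excl rewrite excl refl = refl
    shape false true  false true  true  _    _ = refl
    shape false true  false true  false _    _ = refl
    shape false true  false false _     _    _ = refl

  sumBy-normList : ∀ (h : Triple → ℕ) us →
                   sumBy (h ∘ proj₁) (normList us) ≡ sumBy (λ u → isNormalized u * h u) us
  sumBy-normList h []       = refl
  sumBy-normList h (u ∷ us) with normalized? u in eq
  ... | yes _ = cong₂ _+_ (trans (sym (+-identityʳ (h u))) (weight eq)) (sumBy-normList h us)
    where weight = cong (λ d → 𝟙 (does d) * h u) ∘ sym
  ... | no  _ = trans (sumBy-normList h us) (cong (_+ sumBy (λ u → isNormalized u * h u) us) (weight eq))
    where weight = cong (λ d → 𝟙 (does d) * h u) ∘ sym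

  sumBy-allTriples : ∀ (h : Triple → ℕ) →
                     sumBy h allTriples ≡ sumFin (λ x → sumFin (λ y → sumFin (λ z → h (x , y , z))))
  sumBy-allTriples h =
    trans (sumBy-concatMap h plane (allFin q)) (trans (sumBy-allFin (sumBy h ∘ plane)) (sumFin-cong (λ x →
    trans (sumBy-concatMap h (line x) (allFin q)) (trans (sumBy-allFin (sumBy h ∘ line x)) (sumFin-cong (λ y →
    trans (sumBy-map h (λ z → (x , y , z)) (allFin q)) (sumBy-allFin (λ z → h (x , y , z)))))))))
    where
    line : Fin q → Fin q → List Triple
    line x y = map (λ z → (x , y , z)) (allFin q)
    plane : Fin q → List Triple
    plane x = concatMap (line x) (allFin q)

  ∑P-triples : ∀ (h : Triple → ℕ) →
               ∑P (h ∘ proj₁) ≡ sumFin (λ x → sumFin (λ y → sumFin (λ z → isNormalized (x , y , z) * h (x , y , z))))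
  ∑P-triples h = trans (sumBy-normList h allTriples) (sumBy-allTriples _)

  ∑P-expand : ∀ (h : Triple → ℕ) →
              ∑P (h ∘ proj₁) ≡ sumFin (λ x → sumFin (λ y → h (x , y , 1F)))
                                 + (sumFin (λ x → h (x , 1F , 0F)) + h (1F , 0F , 0F))
  ∑P-expand h = begin
    ∑P (h ∘ proj₁)
      ≡⟨ ∑P-triples h ⟩
    sumFin (λ x → sumFin (λ y → sumFin (λ z → isNormalized (x , y , z) * h (x , y , z))))
      ≡⟨ sumFin-cong (λ x → sumFin-cong (λ y →
           trans (sumFin-cong (λ z → cong (_* h (x , y , z)) (isNormalized-δ x y z))) (δ-split 1F 0F _ _))) ⟩
    sumFin (λ x → sumFin (λ y → h (x , y , 1F) + (δ y 1F + δ y 0F * δ x 1F) * h (x , y , 0F)))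
      ≡⟨ sumFin-cong (λ x → trans (sumFin-+ (λ y → h (x , y , 1F)) _)
                                  (cong (sumFin (λ y → h (x , y , 1F)) +_) (δ-split 1F 0F (δ x 1F) (λ y → h (x , y , 0F))))) ⟩
    sumFin (λ x → sumFin (λ y → h (x , y , 1F)) + (h (x , 1F , 0F) + δ x 1F * h (x , 0F , 0F)))
      ≡⟨ trans (sumFin-+ (λ x → sumFin (λ y → h (x , y , 1F))) _)
               (cong (sumFin (λ x → sumFin (λ y → h (x , y , 1F))) +_)
                 (trans (sumFin-+ (λ x → h (x , 1F , 0F)) (λ x → δ x 1F * h (x , 0F , 0F)))
                        (cong (sumFin (λ x → h (x , 1F , 0F)) +_) (sumFin-δ 1F (λ x → h (x , 0F , 0F)))))) ⟩
    sumFin (λ x → sumFin (λ y → h (x , y , 1F))) + (sumFin (λ x → h (x , 1F , 0F)) + h (1F , 0F , 0F))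
      ∎
    where open ≡-Reasoning

  isZero : Fin q → ℕ
  isZero a = δ a 0F

  isZero-≢0 : ∀ {a} → a ≢ 0F → isZero a ≡ 0
  isZero-≢0 {a} a≢0 = cong 𝟙 (dec-false (a ≟F 0F) a≢0)

  isZero-0 : isZero 0F ≡ 1
  isZero-0 = cong 𝟙 (dec-true (0F ≟F 0F) refl)

  roots-affine : ∀ {u} → u ≢ 0F → ∀ v → sumFin (λ x → isZero (u *ᶠ x +ᶠ v)) ≡ 1
  roots-affine {u} u≢0 v with inverse u u≢0
  ... | w , uw≡1 =
    trans (sumFin-cong (λ x → trans (cong 𝟙 (does-⇔ (mk⇔ to from) (u *ᶠ x +ᶠ v ≟F 0F) (x ≟F root)))
                                    (sym (*-identityʳ _))))
          (sumFin-δ root (λ _ → 1))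
    where
    root = w *ᶠ -F v
    u[w*a]≡a : ∀ a → u *ᶠ (w *ᶠ a) ≡ a
    u[w*a]≡a a = trans (sym (*ᶠ-assoc u w a)) (trans (cong (_*ᶠ a) uw≡1) (*ᶠ-identityˡ a))
    to : ∀ {x} → u *ᶠ x +ᶠ v ≡ 0F → x ≡ root
    to {x} ux+v≡0 = *ᶠ-cancelˡ u≢0 (trans ux≡-v (sym (u[w*a]≡a (-F v))))
      where
      ux≡-v : u *ᶠ x ≡ -F v
      ux≡-v = +ᶠ-cancelʳ v _ _ (trans ux+v≡0 (sym (-ᶠ‿inverseˡ v)))
    from : ∀ {x} → x ≡ root → u *ᶠ x +ᶠ v ≡ 0F
    from refl = trans (cong (_+ᶠ v) (u[w*a]≡a (-F v))) (-ᶠ‿inverseˡ v)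

  roots-constant : ∀ v → sumFin (λ x → isZero (0F *ᶠ x +ᶠ v)) ≡ q * isZero v
  roots-constant v =
    trans (sumFin-cong (λ x → cong isZero (trans (cong (_+ᶠ v) (*ᶠ-zeroˡ x)) (+ᶠ-identityˡ v))))
          (sumFin-const {q} (isZero v))

  roots-linear : ∀ {α β} → α ≢ 0F ⊎ β ≢ 0F → ∀ γ →
                 sumFin (λ x → sumFin (λ y → isZero (α *ᶠ x +ᶠ β *ᶠ y +ᶠ γ))) ≡ q
  roots-linear {α} {β} α≢0⊎β≢0 γ =
    trans (sumFin-cong (λ x → sumFin-cong (λ y → cong isZero (regroup x y)))) (by-β (β ≟F 0F) α≢0⊎β≢0)
    where
    regroup : ∀ x y → α *ᶠ x +ᶠ β *ᶠ y +ᶠ γ ≡ β *ᶠ y +ᶠ (α *ᶠ x +ᶠ γ)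
    regroup x y = solve 5 (λ α β γ x y → α :* x :+ β :* y :+ γ := β :* y :+ (α :* x :+ γ)) refl α β γ x y
    by-β : ∀ {β} → Dec (β ≡ 0F) → α ≢ 0F ⊎ β ≢ 0F →
           sumFin (λ x → sumFin (λ y → isZero (β *ᶠ y +ᶠ (α *ᶠ x +ᶠ γ)))) ≡ q
    by-β (no β≢0) _ =
      trans (sumFin-cong (λ x → roots-affine β≢0 (α *ᶠ x +ᶠ γ))) (trans (sumFin-const {q} 1) (*-identityʳ q))
    by-β (yes refl) (inj₁ α≢0) =
      trans (sumFin-cong (λ x → roots-constant (α *ᶠ x +ᶠ γ)))
            (trans (sumFin-*ˡ q (λ x → isZero (α *ᶠ x +ᶠ γ))) (trans (cong (q *_) (roots-affine α≢0 γ)) (*-identityʳ q)))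
    by-β (yes β≡0) (inj₂ β≢0) = ⊥-elim (β≢0 β≡0)

  δP : Point → Point → ℕ
  δP X Y = 𝟙 (does (X ≟P Y))

  δP-refl : ∀ X → δP X X ≡ 1
  δP-refl X = cong 𝟙 (dec-true (X ≟P X) refl)

  δP-≢ : ∀ {X Y} → X ≢ Y → δP X Y ≡ 0
  δP-≢ {X} {Y} X≢Y = cong 𝟙 (dec-false (X ≟P Y) X≢Y)

  ∑P-δ : ∀ Y → ∑P (λ X → δP X Y) ≡ 1
  ∑P-δ ((a , b , c) , normal) = begin
    ∑P (λ X → 𝟙 (does (proj₁ X ≟T (a , b , c))))
      ≡⟨ ∑P-triples (λ u → 𝟙 (does (u ≟T (a , b , c)))) ⟩
    sumFin (λ x → sumFin (λ y → sumFin (λ z → isNormalized (x , y , z) * 𝟙 (does ((x , y , z) ≟T (a , b , c))))))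
      ≡⟨ sumFin-cong (λ x → sumFin-cong (λ y → sumFin-cong (λ z → factor x y z))) ⟩
    sumFin (λ x → sumFin (λ y → sumFin (λ z → δ x a * (δ y b * (δ z c * isNormalized (x , y , z))))))
      ≡⟨ sumFin-cong (λ x → trans (sumFin-cong (λ y → pull-out (δ x a) (λ z → δ y b * (δ z c * isNormalized (x , y , z)))
                                                       (pull-out (δ y b) (λ z → δ z c * isNormalized (x , y , z))
                                                                 (sumFin-δ c (λ z → isNormalized (x , y , z))))))
                                  (pull-out (δ x a) (λ y → δ y b * isNormalized (x , y , c))
                                            (sumFin-δ b (λ y → isNormalized (x , y , c))))) ⟩
    sumFin (λ x → δ x a * isNormalized (x , b , c))
      ≡⟨ sumFin-δ a (λ x → isNormalized (x , b , c)) ⟩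
    isNormalized (a , b , c)
      ≡⟨ cong 𝟙 (dec-true (normalized? (a , b , c)) normal) ⟩
    1 ∎
    where
    open ≡-Reasoning
    reassociate : ∀ n x y z → n * (x * (y * z)) ≡ x * (y * (z * n))
    reassociate = solve-∀
    factor : ∀ x y z → isNormalized (x , y , z) * 𝟙 (does ((x , y , z) ≟T (a , b , c)))
                     ≡ δ x a * (δ y b * (δ z c * isNormalized (x , y , z)))
    factor x y z =
      trans (cong (isNormalized (x , y , z) *_)
                  (trans (𝟙-∧ (does (x ≟F a)) _) (cong (δ x a *_) (𝟙-∧ (does (y ≟F b)) (does (z ≟F c))))))
            (reassociate (isNormalized (x , y , z)) (δ x a) (δ y b) (δ z c))
    pull-out : ∀ k (f : Fin q → ℕ) {s} → sumFin (λ i → f i) ≡ s → sumFin (λ i → k * f i) ≡ k * s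
    pull-out k f sum≡s = trans (sumFin-*ˡ k f) (cong (k *_) sum≡s)

  ·-affine : ∀ a b c x y → (a , b , c) · (x , y , 1F) ≡ a *ᶠ x +ᶠ b *ᶠ y +ᶠ c
  ·-affine a b c x y = cong (a *ᶠ x +ᶠ b *ᶠ y +ᶠ_) (*ᶠ-identityʳ c)

  ·-infinite : ∀ a b c x → (a , b , c) · (x , 1F , 0F) ≡ a *ᶠ x +ᶠ b
  ·-infinite a b c x =
    trans (cong₂ _+ᶠ_ (cong (a *ᶠ x +ᶠ_) (*ᶠ-identityʳ b)) (*ᶠ-zeroʳ c)) (+ᶠ-identityʳ _)

  ·-corner : ∀ a b c → (a , b , c) · (1F , 0F , 0F) ≡ a
  ·-corner a b c =
    trans (cong₂ _+ᶠ_ (trans (cong₂ _+ᶠ_ (*ᶠ-identityʳ a) (*ᶠ-zeroʳ b)) (+ᶠ-identityʳ a)) (*ᶠ-zeroʳ c))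
          (+ᶠ-identityʳ a)

  ·-comm : ∀ u v → u · v ≡ v · u
  ·-comm (a , b , c) (x , y , z) = cong₂ _+ᶠ_ (cong₂ _+ᶠ_ (*ᶠ-comm a x) (*ᶠ-comm b y)) (*ᶠ-comm c z)

  expandedLineCount : Fin q → Fin q → Fin q → ℕ
  expandedLineCount a b c = sumFin (λ x → sumFin (λ y → isZero (a *ᶠ x +ᶠ b *ᶠ y +ᶠ c)))
                       + (sumFin (λ x → isZero (a *ᶠ x +ᶠ b)) + isZero a)

  expandedLineCount≡ : ∀ {a b c} → Nonzero (a , b , c) → expandedLineCount a b c ≡ suc q
  expandedLineCount≡ {a} {b} {c} abc≢0 with a ≟F 0F | b ≟F 0F
  ... | no a≢0 | _ =
    trans (cong₂ _+_ (roots-linear (inj₁ a≢0) c) (cong (_+ 0) (roots-affine a≢0 b)))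
          (+-comm q 1)
  ... | yes refl | no b≢0 =
    trans (cong₂ _+_ (roots-linear (inj₂ b≢0) c)
                     (cong (_+ 1) (trans (roots-constant b) (trans (cong (q *_) (isZero-≢0 b≢0)) (*-zeroʳ q)))))
          (+-comm q 1)
  ... | yes refl | yes refl =
    cong₂ _+_ (sumFin-zero (λ x → sumFin-zero (λ y → isZero-≢0 (c≢0 ∘ trans (sym (only-c x y))))))
              (trans (cong (_+ 1) (trans (roots-constant 0F) (trans (cong (q *_) isZero-0) (*-identityʳ q))))
                     (+-comm q 1))
    where
    c≢0 : c ≢ 0F
    c≢0 = abc≢0 refl refl
    only-c : ∀ x y → 0F *ᶠ x +ᶠ 0F *ᶠ y +ᶠ c ≡ c
    only-c x y = trans (cong (_+ᶠ c) (trans (cong₂ _+ᶠ_ (*ᶠ-zeroˡ x) (*ᶠ-zeroˡ y)) (+ᶠ-identityˡ 0F)))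
                       (+ᶠ-identityˡ c)

  points-on-line : ∀ l → # (pointsOf l) ≡ suc q
  points-on-line ((a , b , c) , normal) = begin
    ∑P ((λ v → isZero ((a , b , c) · v)) ∘ proj₁)
      ≡⟨ ∑P-expand (λ v → isZero ((a , b , c) · v)) ⟩
    sumFin (λ x → sumFin (λ y → isZero ((a , b , c) · (x , y , 1F))))
      + (sumFin (λ x → isZero ((a , b , c) · (x , 1F , 0F))) + isZero ((a , b , c) · (1F , 0F , 0F)))
      ≡⟨ cong₂ _+_ (sumFin-cong (λ x → sumFin-cong (λ y → cong isZero (·-affine a b c x y))))
                   (cong₂ _+_ (sumFin-cong (λ x → cong isZero (·-infinite a b c x))) (cong isZero (·-corner a b c))) ⟩
    expandedLineCount a b c
      ≡⟨ expandedLineCount≡ (normalized⇒nonzero _ normal) ⟩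
    suc q ∎
    where open ≡-Reasoning

  pointsOf-comm : ∀ X l → pointsOf l X ≡ pointsOf X l
  pointsOf-comm X l = cong (λ e → does (e ≟F 0F)) (·-comm (proj₁ l) (proj₁ X))

  lines-through-point : ∀ X → # (λ l → pointsOf l X) ≡ suc q
  lines-through-point X = trans (sumBy-cong allPoints (λ l → cong 𝟙 (pointsOf-comm X l))) (points-on-line X)

  number-of-points : ∑P (λ _ → 1) ≡ q * q + q + 1
  number-of-points =
    trans (∑P-expand (λ _ → 1))
          (trans (cong₂ _+_ (trans (sumFin-cong {q} (λ _ → sumFin-const {q} 1)) (sumFin-const {q} (q * 1)))
                            (cong (_+ 1) (sumFin-const {q} 1)))
                 (tidy q))
    where
    tidy : ∀ q → q * (q * 1) + (q * 1 + 1) ≡ q * q + q + 1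
    tidy = solve-∀


  ∑P-select : ∀ (g : Point → ℕ) X → ∑P (λ Y → g Y * δP Y X) ≡ g X
  ∑P-select g X =
    trans (sumBy-cong allPoints pointwise)
          (trans (sumBy-*ˡ (g X) _ allPoints) (trans (cong (g X *_) (∑P-δ X)) (*-identityʳ (g X))))
    where
    pointwise : ∀ Y → g Y * δP Y X ≡ g X * δP Y X
    pointwise Y with Y ≟P X
    ... | yes refl = refl
    ... | no  Y≢X  = trans (cong (g Y *_) (δP-≢ Y≢X))
                           (trans (*-zeroʳ (g Y)) (sym (trans (cong (g X *_) (δP-≢ Y≢X)) (*-zeroʳ (g X)))))

  #-positive : ∀ T → 1 ≤ # T → ∃[ X ] T X ≡ true
  #-positive T pos = let (X , 1≤TX) = sumBy-positive (𝟙 ∘ T) allPoints pos in X , 𝟙-positive 1≤TX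

  #-≥1 : ∀ T X → T X ≡ true → 1 ≤ # T
  #-≥1 T X TX = subst (_≤ # T) (∑P-δ X) (sumBy-mono allPoints pointwise)
    where
    pointwise : ∀ Y → δP Y X ≤ 𝟙 (T Y)
    pointwise Y with Y ≟P X
    ... | yes refl = ≤-reflexive (trans (δP-refl X) (cong 𝟙 (sym TX)))
    ... | no  Y≢X  = ≤-trans (≤-reflexive (δP-≢ Y≢X)) z≤n

  #-≤1 : ∀ T → (∀ X Y → T X ≡ true → T Y ≡ true → X ≡ Y) → # T ≤ 1
  #-≤1 T unique with 1 ≤? # T
  ... | no  ¬pos = <⇒≤ (≰⇒> ¬pos)
  ... | yes pos  = subst (# T ≤_) (∑P-δ X) (sumBy-mono allPoints pointwise)
    where
    X = proj₁ (#-positive T pos)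
    TX = proj₂ (#-positive T pos)
    pointwise : ∀ Y → 𝟙 (T Y) ≤ δP Y X
    pointwise Y with T Y in TY
    ... | false = z≤n
    ... | true  = ≤-reflexive (sym (trans (cong (λ Z → δP Z X) (unique Y X TY TX)) (δP-refl X)))

  #-≡1 : ∀ T X → T X ≡ true → (∀ Y → T Y ≡ true → Y ≡ X) → # T ≡ 1
  #-≡1 T X TX unique = ≤-antisym (#-≤1 T (λ Y Y' TY TY' → trans (unique Y TY) (sym (unique Y' TY')))) (#-≥1 T X TX)

  on-line⇒∈L : ∀ {X l} → pointsOf l X ≡ true → X ∈L l
  on-line⇒∈L {X} {l} = does-true⇒ (X ∈L? l)

  ∈L⇒on-line : ∀ {X l} → X ∈L l → pointsOf l X ≡ true
  ∈L⇒on-line {X} {l} = dec-true (X ∈L? l)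

  linesThrough : Point → Point → ℕ
  linesThrough X Y = # (λ l → pointsOf l X ∧ pointsOf l Y)

  on-both : ∀ {X Y l} → (pointsOf l X ∧ pointsOf l Y) ≡ true → X ∈L l × Y ∈L l
  on-both {X} {Y} {l} on =
    on-line⇒∈L {X} {l} (∧-conicalˡ _ _ on) , on-line⇒∈L {Y} {l} (∧-conicalʳ (pointsOf l X) _ on)

  linesThrough-≤1 : ∀ {X Y} → X ≢ Y → linesThrough X Y ≤ 1
  linesThrough-≤1 {X} {Y} X≢Y = #-≤1 _ λ l n onl onn →
    let (Xl , Yl) = on-both {X} {Y} {l} onl ; (Xn , Yn) = on-both {X} {Y} {n} onn in unique-line X≢Y Xl Yl Xn Yn

  linesThrough-self : ∀ X → linesThrough X X ≡ suc q
  linesThrough-self X = trans (sumBy-cong allPoints (λ l → cong 𝟙 (∧-idem (pointsOf l X)))) (lines-through-point X)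

  ∑linesThrough : ∀ X → ∑P (linesThrough X) ≡ suc q * suc q
  ∑linesThrough X = begin
    ∑P (λ Z → ∑P (λ l → 𝟙 (pointsOf l X ∧ pointsOf l Z)))
      ≡⟨ sumBy-comm (λ Z l → 𝟙 (pointsOf l X ∧ pointsOf l Z)) allPoints allPoints ⟩
    ∑P (λ l → ∑P (λ Z → 𝟙 (pointsOf l X ∧ pointsOf l Z)))
      ≡⟨ sumBy-cong allPoints (λ l → trans (sumBy-cong allPoints (λ Z → 𝟙-∧ (pointsOf l X) (pointsOf l Z)))
                                           (sumBy-*ˡ (𝟙 (pointsOf l X)) (𝟙 ∘ pointsOf l) allPoints)) ⟩
    ∑P (λ l → 𝟙 (pointsOf l X) * # (pointsOf l))
      ≡⟨ sumBy-cong allPoints (λ l → trans (cong (𝟙 (pointsOf l X) *_) (points-on-line l)) (*-comm _ (suc q))) ⟩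
    ∑P (λ l → suc q * 𝟙 (pointsOf l X))
      ≡⟨ trans (sumBy-*ˡ (suc q) (λ l → 𝟙 (pointsOf l X)) allPoints) (cong (suc q *_) (lines-through-point X)) ⟩
    suc q * suc q ∎
    where open ≡-Reasoning

  -- If X ≠ Y were on no common line, the (q + 1)q points ≠ X on the lines through X, all
  -- distinct, would avoid Y: one more than the q² + q − 1 points other than X and Y.
  linesThrough-nonzero : ∀ X Y → linesThrough X Y ≢ 0
  linesThrough-nonzero X Y none with X ≟P Y
  ... | yes refl = 1+n≢0 (trans (sym (linesThrough-self X)) none)
  ... | no  X≢Y  = 1+n≰n (begin
    suc (q * q + q + 1 + q * 1)  ≡⟨ excess q ⟩
    suc q * suc q + 1            ≡⟨ sym (trans (sumBy-+ (linesThrough X) (λ Z → δP Z Y) allPoints)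
                                               (cong₂ _+_ (∑linesThrough X) (∑P-δ Y))) ⟩
    ∑P (λ Z → linesThrough X Z + δP Z Y) ≤⟨ sumBy-mono allPoints bound ⟩
    ∑P (λ Z → 1 + q * δP Z X)    ≡⟨ trans (sumBy-+ (λ _ → 1) (λ Z → q * δP Z X) allPoints)
                                          (cong₂ _+_ number-of-points
                                                     (trans (sumBy-*ˡ q (λ Z → δP Z X) allPoints) (cong (q *_) (∑P-δ X)))) ⟩
    q * q + q + 1 + q * 1        ∎)
    where
    open ≤-Reasoning
    excess : ∀ q → suc (q * q + q + 1 + q * 1) ≡ suc q * suc q + 1
    excess = solve-∀
    bound : ∀ Z → linesThrough X Z + δP Z Y ≤ 1 + q * δP Z X
    bound Z with Z ≟P X | Z ≟P Y
    ... | yes refl | yes refl = ⊥-elim (X≢Y refl)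
    ... | yes refl | no  X≢Y' = ≤-reflexive (begin-equality
      linesThrough X X + δP X Y  ≡⟨ cong₂ _+_ (linesThrough-self X) (δP-≢ X≢Y') ⟩
      suc q + 0                  ≡⟨ cong suc (trans (+-identityʳ q) (sym (*-identityʳ q))) ⟩
      1 + q * 1                  ≡⟨ cong (λ d → 1 + q * d) (sym (δP-refl X)) ⟩
      1 + q * δP X X             ∎)
    ... | no  Y≢X  | yes refl = ≤-trans (≤-reflexive (cong (_+ δP Y Y) none)) (≤-trans (≤-reflexive (δP-refl Y)) (m≤m+n 1 _))
    ... | no  Z≢X  | no  Z≢Y  =
      ≤-trans (≤-reflexive (cong (linesThrough X Z +_) (δP-≢ Z≢Y)))
              (≤-trans (≤-reflexive (+-identityʳ _)) (≤-trans (linesThrough-≤1 (Z≢X ∘ sym)) (m≤m+n 1 _)))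

  join : ∀ X Y → ∃[ l ] (X ∈L l × Y ∈L l)
  join X Y = let (l , on) = #-positive _ (n≢0⇒n>0 (linesThrough-nonzero X Y)) in l , on-both {X} {Y} {l} on

  linesThrough≡ : ∀ X Y → linesThrough X Y ≡ 1 + q * δP Y X
  linesThrough≡ X Y with Y ≟P X
  ... | yes refl = trans (linesThrough-self X) (cong suc (sym (trans (cong (q *_) (δP-refl X)) (*-identityʳ q))))
  ... | no  Y≢X  = trans (≤-antisym (linesThrough-≤1 (Y≢X ∘ sym)) (n≢0⇒n>0 (linesThrough-nonzero X Y)))
                         (cong suc (sym (trans (cong (q *_) (δP-≢ Y≢X)) (*-zeroʳ q))))

  pencil-sum : ∀ X (S : PointSet) → ∑P (λ l → 𝟙 (pointsOf l X) * meet l S) ≡ # S + q * 𝟙 (S X)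
  pencil-sum X S = begin
    ∑P (λ l → 𝟙 (pointsOf l X) * meet l S)
      ≡⟨ sumBy-cong allPoints (λ l → trans (cong (𝟙 (pointsOf l X) *_) (meet≡# l S))
                                           (sym (sumBy-*ˡ (𝟙 (pointsOf l X)) _ allPoints))) ⟩
    ∑P (λ l → ∑P (λ Y → 𝟙 (pointsOf l X) * 𝟙 (pointsOf l Y ∧ S Y)))
      ≡⟨ sumBy-comm (λ l Y → 𝟙 (pointsOf l X) * 𝟙 (pointsOf l Y ∧ S Y)) allPoints allPoints ⟩
    ∑P (λ Y → ∑P (λ l → 𝟙 (pointsOf l X) * 𝟙 (pointsOf l Y ∧ S Y)))
      ≡⟨ sumBy-cong allPoints (λ Y → trans (sumBy-cong allPoints (λ l → 𝟙-swap (pointsOf l X) (pointsOf l Y) (S Y)))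
                                           (sumBy-*ˡ (𝟙 (S Y)) _ allPoints)) ⟩
    ∑P (λ Y → 𝟙 (S Y) * linesThrough X Y)
      ≡⟨ sumBy-cong allPoints (λ Y → trans (cong (𝟙 (S Y) *_) (linesThrough≡ X Y)) (expand (𝟙 (S Y)) q (δP Y X))) ⟩
    ∑P (λ Y → 𝟙 (S Y) + q * (𝟙 (S Y) * δP Y X))
      ≡⟨ sumBy-+ (𝟙 ∘ S) (λ Y → q * (𝟙 (S Y) * δP Y X)) allPoints ⟩
    # S + ∑P (λ Y → q * (𝟙 (S Y) * δP Y X))
      ≡⟨ cong (# S +_) (trans (sumBy-*ˡ q (λ Y → 𝟙 (S Y) * δP Y X) allPoints) (cong (q *_) (∑P-select (𝟙 ∘ S) X))) ⟩
    # S + q * 𝟙 (S X) ∎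
    where
    open ≡-Reasoning
    expand : ∀ s q d → s * (1 + q * d) ≡ s + q * (s * d)
    expand = solve-∀

  double-counting : ∀ (A B : Point → Bool) (R : Point → Point → Bool) →
                    (∀ l → A l ≡ true → # (λ Y → B Y ∧ R l Y) ≡ 1) →
                    (∀ Y → B Y ≡ true → # (λ l → A l ∧ R l Y) ≡ 1) → # A ≡ # B
  double-counting A B R one-per-A one-per-B = begin
    # A
      ≡⟨ sumBy-cong allPoints (λ l → scale (A l) (one-per-A l)) ⟩
    ∑P (λ l → 𝟙 (A l) * # (λ Y → B Y ∧ R l Y))
      ≡⟨ sumBy-cong allPoints (λ l → sym (sumBy-*ˡ (𝟙 (A l)) _ allPoints)) ⟩
    ∑P (λ l → ∑P (λ Y → 𝟙 (A l) * 𝟙 (B Y ∧ R l Y)))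
      ≡⟨ sumBy-comm (λ l Y → 𝟙 (A l) * 𝟙 (B Y ∧ R l Y)) allPoints allPoints ⟩
    ∑P (λ Y → ∑P (λ l → 𝟙 (A l) * 𝟙 (B Y ∧ R l Y)))
      ≡⟨ sumBy-cong allPoints (λ Y → trans (sumBy-cong allPoints (λ l → swap (A l) (B Y) (R l Y)))
                                           (sumBy-*ˡ (𝟙 (B Y)) _ allPoints)) ⟩
    ∑P (λ Y → 𝟙 (B Y) * # (λ l → A l ∧ R l Y))
      ≡⟨ sumBy-cong allPoints (λ Y → sym (scale (B Y) (one-per-B Y))) ⟩
    # B ∎
    where
    open ≡-Reasoning
    scale : ∀ b {k} → (b ≡ true → k ≡ 1) → 𝟙 b ≡ 𝟙 b * k
    scale true  k≡1 = sym (trans (+-identityʳ _) (k≡1 refl))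
    scale false _   = refl
    swap : ∀ a b r → 𝟙 a * 𝟙 (b ∧ r) ≡ 𝟙 b * 𝟙 (a ∧ r)
    swap a b r = trans (cong (λ c → 𝟙 a * 𝟙 c) (∧-comm b r)) (𝟙-swap a r b)

module Subplanes {q : ℕ} (F : FiniteField q) {m : ℕ} {Bp : PG.PointSet F} {Bl : PG.LineSet F}
                 (subplane : PG.IsSubplane F m Bp Bl) where

  open PG F
  open Incidence F
  open Counting F
  open IsSubplane subplane

  meet-≤1 : ∀ l → Bl l ≡ false → meet l Bp ≤ 1
  meet-≤1 l l∉Bl = subst (_≤ 1) (sym (meet≡# l Bp)) (#-≤1 (pointsOf l ∩ Bp) same)
    where
    same : ∀ X Y → (pointsOf l ∩ Bp) X ≡ true → (pointsOf l ∩ Bp) Y ≡ true → X ≡ Y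
    same X Y onX onY with X ≟P Y
    ... | yes X≡Y = X≡Y
    ... | no  X≢Y =
      let (n , n∈Bl , Xn , Yn) = joinIn X Y (∧-conicalʳ _ _ onX) (∧-conicalʳ (pointsOf l Y) _ onY) X≢Y
          l≡n = unique-line X≢Y (on-line⇒∈L {X} {l} (∧-conicalˡ _ _ onX)) (on-line⇒∈L {Y} {l} (∧-conicalˡ _ _ onY)) Xn Yn
      in ⊥-elim (false≢true (trans (sym l∉Bl) (trans (cong Bl l≡n) n∈Bl)))

  two-points⇒subplane-line : ∀ l → 2 ≤ meet l Bp → Bl l ≡ true
  two-points⇒subplane-line l two with Bl l in l∈Bl
  ... | true  = refl
  ... | false = ⊥-elim (1+n≰n (≤-trans two (meet-≤1 l l∈Bl)))

  meet≤ : ∀ l → meet l Bp ≤ 1 + m * 𝟙 (Bl l)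
  meet≤ l with Bl l in l∈Bl
  ... | true  = ≤-reflexive (trans (order l l∈Bl) (cong suc (sym (*-identityʳ m))))
  ... | false = ≤-trans (meet-≤1 l l∈Bl) (m≤m+n 1 _)

  meet-through : ∀ {P l} → P ∈ Bp → P ∈L l → Bl l ≡ false → meet l Bp ≡ 1
  meet-through {P} {l} P∈Bp Pl l∉Bl =
    ≤-antisym (meet-≤1 l l∉Bl)
              (subst (1 ≤_) (sym (meet≡# l Bp)) (#-≥1 (pointsOf l ∩ Bp) P (cong₂ _∧_ (∈L⇒on-line {P} {l} Pl) P∈Bp)))

  subplane-pencil : ∀ {P ℓ₀} → P ∈ Bp → Bl ℓ₀ ≡ true → ¬ P ∈L ℓ₀ → # (λ l → pointsOf l P ∧ Bl l) ≡ suc m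
  subplane-pencil {P} {ℓ₀} P∈Bp ℓ₀∈Bl P∉ℓ₀ =
    trans (double-counting (λ l → pointsOf l P ∧ Bl l) (pointsOf ℓ₀ ∩ Bp) (λ l Y → pointsOf l Y)
                           one-point one-line)
          (trans (sym (meet≡# ℓ₀ Bp)) (order ℓ₀ ℓ₀∈Bl))
    where
    one-point : ∀ l → (pointsOf l P ∧ Bl l) ≡ true → # (λ Y → (pointsOf ℓ₀ Y ∧ Bp Y) ∧ pointsOf l Y) ≡ 1
    one-point l on =
      let l∈Bl = ∧-conicalʳ (pointsOf l P) _ on
          l≢ℓ₀ : l ≢ ℓ₀
          l≢ℓ₀ = λ { refl → P∉ℓ₀ (on-line⇒∈L {P} {l} (∧-conicalˡ _ _ on)) }
          (Y , Y∈Bp , Yl , Yℓ₀) = meetIn l ℓ₀ l∈Bl ℓ₀∈Bl l≢ℓ₀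
      in #-≡1 _ Y (cong₂ _∧_ (cong₂ _∧_ (∈L⇒on-line {Y} {ℓ₀} Yℓ₀) Y∈Bp) (∈L⇒on-line {Y} {l} Yl))
              (λ Z onZ → unique-meet l≢ℓ₀ (on-line⇒∈L {Z} {l} (∧-conicalʳ (pointsOf ℓ₀ Z ∧ Bp Z) _ onZ)) Yl
                                          (on-line⇒∈L {Z} {ℓ₀} (∧-conicalˡ _ _ (∧-conicalˡ _ _ onZ))) Yℓ₀)
    one-line : ∀ Y → (pointsOf ℓ₀ Y ∧ Bp Y) ≡ true → # (λ l → (pointsOf l P ∧ Bl l) ∧ pointsOf l Y) ≡ 1
    one-line Y on =
      let Yℓ₀ = on-line⇒∈L {Y} {ℓ₀} (∧-conicalˡ _ _ on)
          P≢Y : P ≢ Y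
          P≢Y = λ { refl → P∉ℓ₀ Yℓ₀ }
          (n , n∈Bl , Pn , Yn) = joinIn P Y P∈Bp (∧-conicalʳ (pointsOf ℓ₀ Y) _ on) P≢Y
      in #-≡1 _ n (cong₂ _∧_ (cong₂ _∧_ (∈L⇒on-line {P} {n} Pn) n∈Bl) (∈L⇒on-line {Y} {n} Yn))
              (λ l onl → unique-line P≢Y (on-line⇒∈L {P} {l} (∧-conicalˡ _ _ (∧-conicalˡ _ _ onl)))
                                         (on-line⇒∈L {Y} {l} (∧-conicalʳ (pointsOf l P ∧ Bl l) _ onl)) Pn Yn)

  ∑pencil : ∀ Z → ∑P (λ l → 𝟙 (pointsOf l Z) + m * 𝟙 (pointsOf l Z ∧ Bl l))
                  ≡ suc q + m * # (λ l → pointsOf l Z ∧ Bl l)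
  ∑pencil Z = trans (sumBy-+ (λ l → 𝟙 (pointsOf l Z)) (λ l → m * 𝟙 (pointsOf l Z ∧ Bl l)) allPoints)
                    (cong₂ _+_ (lines-through-point Z) (sumBy-*ˡ m (λ l → 𝟙 (pointsOf l Z ∧ Bl l)) allPoints))

  size : # Bp ≡ suc (m * suc m)
  size with quadrangle
  ... | P , Q , R , _ , P∈Bp , Q∈Bp , R∈Bp , _ , ¬PQR , _ =
    +-cancelʳ-≡ q _ _ (begin
      # Bp + q                                 ≡⟨ cong (# Bp +_) (trans (sym (*-identityʳ q))
                                                                        (cong (λ b → q * 𝟙 b) (sym P∈Bp))) ⟩
      # Bp + q * 𝟙 (Bp P)                      ≡⟨ sym (pencil-sum P Bp) ⟩
      ∑P (λ l → 𝟙 (pointsOf l P) * meet l Bp) ≡⟨ sumBy-cong allPoints pencil-term ⟩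
      ∑P (λ l → 𝟙 (pointsOf l P) + m * 𝟙 (pointsOf l P ∧ Bl l))
                                               ≡⟨ ∑pencil P ⟩
      suc q + m * # (λ l → pointsOf l P ∧ Bl l) ≡⟨ cong (λ k → suc q + m * k) (subplane-pencil P∈Bp ℓ₀∈Bl P∉ℓ₀) ⟩
      suc q + m * suc m                        ≡⟨ trans (+-comm (suc q) _) (+-suc _ q) ⟩
      suc (m * suc m) + q                      ∎)
    where
    open ≡-Reasoning
    Q≢R : Q ≢ R
    Q≢R refl = let (n , Pn , Qn) = join P Q in ¬PQR (n , Pn , Qn , Qn)
    ℓ₀ = proj₁ (joinIn Q R Q∈Bp R∈Bp Q≢R)
    ℓ₀∈Bl = proj₁ (proj₂ (joinIn Q R Q∈Bp R∈Bp Q≢R))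
    P∉ℓ₀ : ¬ P ∈L ℓ₀
    P∉ℓ₀ Pℓ₀ = let (_ , _ , Qℓ₀ , Rℓ₀) = joinIn Q R Q∈Bp R∈Bp Q≢R in ¬PQR (ℓ₀ , Pℓ₀ , Qℓ₀ , Rℓ₀)
    pencil-term : ∀ l → 𝟙 (pointsOf l P) * meet l Bp ≡ 𝟙 (pointsOf l P) + m * 𝟙 (pointsOf l P ∧ Bl l)
    pencil-term l with pointsOf l P in Pl | Bl l in l∈Bl
    ... | false | _     = sym (*-zeroʳ m)
    ... | true  | true  = trans (+-identityʳ _) (trans (order l l∈Bl) (cong suc (sym (*-identityʳ m))))
    ... | true  | false = trans (+-identityʳ _)
                                (trans (meet-through P∈Bp (on-line⇒∈L {P} {l} Pl) l∈Bl) (cong suc (sym (*-zeroʳ m))))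

  subplane-lines-through-outside : ∀ {Z} → Bp Z ≡ false → # (λ n → pointsOf n Z ∧ Bl n) ≤ 1
  subplane-lines-through-outside {Z} Z∉Bp = #-≤1 _ same
    where
    same : ∀ n n' → (pointsOf n Z ∧ Bl n) ≡ true → (pointsOf n' Z ∧ Bl n') ≡ true → n ≡ n'
    same n n' on on' with n ≟P n'
    ... | yes n≡n' = n≡n'
    ... | no  n≢n' =
      let (Y , Y∈Bp , Yn , Yn') = meetIn n n' (∧-conicalʳ (pointsOf n Z) _ on) (∧-conicalʳ (pointsOf n' Z) _ on') n≢n'
          Z≡Y = unique-meet n≢n' (on-line⇒∈L {Z} {n} (∧-conicalˡ _ _ on)) Yn (on-line⇒∈L {Z} {n'} (∧-conicalˡ _ _ on')) Yn'
      in ⊥-elim (false≢true (trans (sym Z∉Bp) (trans (cong Bp Z≡Y) Y∈Bp)))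

  -- At most one line of B passes through Z ∉ B, so along the q + 1 lines through Z, one of
  -- which misses B, there are at most (m + 1) + (q − 1) points of B.
  missing-line-bound : ∀ {Z l} → Bp Z ≡ false → pointsOf l Z ≡ true → meet l Bp ≡ 0 → suc (# Bp) ≤ suc q + m
  missing-line-bound {Z} {l} Z∉Bp Zl miss = begin
    suc (# Bp)                                                    ≡⟨ +-comm 1 (# Bp) ⟩
    # Bp + 1                                                      ≡⟨ cong₂ _+_ (sym pencil) (sym (∑P-δ l)) ⟩
    ∑P (λ n → 𝟙 (pointsOf n Z) * meet n Bp) + ∑P (λ n → δP n l)
      ≡⟨ sym (sumBy-+ (λ n → 𝟙 (pointsOf n Z) * meet n Bp) (λ n → δP n l) allPoints) ⟩
    ∑P (λ n → 𝟙 (pointsOf n Z) * meet n Bp + δP n l)              ≤⟨ sumBy-mono allPoints bound ⟩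
    ∑P (λ n → 𝟙 (pointsOf n Z) + m * 𝟙 (pointsOf n Z ∧ Bl n))    ≡⟨ ∑pencil Z ⟩
    suc q + m * # (λ n → pointsOf n Z ∧ Bl n)                    ≤⟨ +-monoʳ-≤ (suc q) (*-monoʳ-≤ m (subplane-lines-through-outside Z∉Bp)) ⟩
    suc q + m * 1                                                 ≡⟨ cong (suc q +_) (*-identityʳ m) ⟩
    suc q + m                                                     ∎
    where
    open ≤-Reasoning
    pencil : ∑P (λ n → 𝟙 (pointsOf n Z) * meet n Bp) ≡ # Bp
    pencil = trans (pencil-sum Z Bp)
                   (trans (cong (λ b → # Bp + q * 𝟙 b) Z∉Bp) (trans (cong (# Bp +_) (*-zeroʳ q)) (+-identityʳ _)))
    pencil-bound : ∀ n → 𝟙 (pointsOf n Z) * meet n Bp ≤ 𝟙 (pointsOf n Z) + m * 𝟙 (pointsOf n Z ∧ Bl n)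
    pencil-bound n with pointsOf n Z
    ... | false = z≤n
    ... | true  = ≤-trans (≤-reflexive (+-identityʳ _)) (meet≤ n)
    bound : ∀ n → 𝟙 (pointsOf n Z) * meet n Bp + δP n l ≤ 𝟙 (pointsOf n Z) + m * 𝟙 (pointsOf n Z ∧ Bl n)
    bound n with n ≟P l
    ... | yes refl = subst (λ b → 𝟙 b * meet l Bp + δP l l ≤ 𝟙 b + m * 𝟙 (b ∧ Bl l)) (sym Zl)
                           (≤-trans (≤-reflexive (cong₂ _+_ (trans (+-identityʳ _) miss) (δP-refl l))) (m≤m+n 1 _))
    ... | no  n≢l  = ≤-trans (≤-reflexive (trans (cong (_ +_) (δP-≢ n≢l)) (+-identityʳ _))) (pencil-bound n)

  baer-meets-every-line : q ≡ m * m → ∀ l → 1 ≤ meet l Bp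
  baer-meets-every-line q≡m² l with 1 ≤? meet l Bp
  ... | yes pos  = pos
  ... | no  ¬pos with #-positive (pointsOf l) (subst (1 ≤_) (sym (points-on-line l)) (s≤s z≤n))
  ...   | Z , Zl with Bp Z in Z∈Bp
  ...     | true  = ⊥-elim (¬pos (subst (1 ≤_) (sym (meet≡# l Bp)) (#-≥1 (pointsOf l ∩ Bp) Z (cong₂ _∧_ Zl Z∈Bp))))
  ...     | false = ⊥-elim (1+n≰n (≤-trans (missing-line-bound {Z} {l} Z∈Bp Zl (n<1⇒n≡0 (≰⇒> ¬pos)))
                                          (≤-reflexive (trans (cong (λ k → suc k + m) q≡m²) (trans (tidy m) (sym size))))))
    where
    tidy : ∀ m → suc (m * m) + m ≡ suc (m * suc m)
    tidy = solve-∀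

module PointSets {q : ℕ} (F : FiniteField q) where

  open PG F
  open Incidence F
  open Counting F

  _⊆_ : PointSet → PointSet → Set
  S ⊆ T = ∀ X → S X ≡ true → T X ≡ true

  Disjoint : ∀ {n} → (Fin n → PointSet) → Set
  Disjoint T = ∀ i j → i ≢ j → ∀ X → T i X ≡ true → T j X ≡ false

  ⋃-anyFin : ∀ {n} (T : Fin n → PointSet) X → ⋃ T X ≡ anyFin (λ i → T i X)
  ⋃-anyFin T X = any-allFin (λ i → T i X)

  ∩-⋃ : ∀ {n} S (T : Fin n → PointSet) X → (S ∩ ⋃ T) X ≡ ⋃ (λ i → S ∩ T i) X
  ∩-⋃ S T X = trans (cong (S X ∧_) (⋃-anyFin T X)) (trans (∧-anyFin (S X) (λ i → T i X)) (sym (⋃-anyFin (λ i → S ∩ T i) X)))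

  #-cong : ∀ {S T} → (∀ X → S X ≡ T X) → # S ≡ # T
  #-cong S≗T = sumBy-cong allPoints (cong 𝟙 ∘ S≗T)

  #-mono : ∀ {S T} → S ⊆ T → # S ≤ # T
  #-mono S⊆T = sumBy-mono allPoints (λ X → 𝟙-mono (S⊆T X))

  #-∪-≤ : ∀ S T → # (S ∪ T) ≤ # S + # T
  #-∪-≤ S T = ≤-trans (sumBy-mono allPoints (λ X → 𝟙-∨-≤ (S X) (T X))) (≤-reflexive (sumBy-+ (𝟙 ∘ S) (𝟙 ∘ T) allPoints))

  #-⋃-≤ : ∀ {n} (T : Fin n → PointSet) → # (⋃ T) ≤ sumFin (λ i → # (T i))
  #-⋃-≤ T = ≤-trans (sumBy-mono allPoints (λ X → ≤-trans (≤-reflexive (cong 𝟙 (⋃-anyFin T X))) (𝟙-anyFin-≤ (λ i → T i X))))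
                    (≤-reflexive (sym (sumFin-sumBy-comm (λ i X → 𝟙 (T i X)) allPoints)))

  #-⋃ : ∀ {n} (T : Fin n → PointSet) → Disjoint T → # (⋃ T) ≡ sumFin (λ i → # (T i))
  #-⋃ T disjoint =
    trans (sumBy-cong allPoints (λ X → trans (cong 𝟙 (⋃-anyFin T X))
                                             (𝟙-anyFin-disjoint (λ i → T i X) (λ i j i≢j → disjoint i j i≢j X))))
          (sym (sumFin-sumBy-comm (λ i X → 𝟙 (T i X)) allPoints))

  meet-mono : ∀ l {S T} → S ⊆ T → meet l S ≤ meet l T
  meet-mono l S⊆T = subst₂ _≤_ (sym (meet≡# l _)) (sym (meet≡# l _))
    (#-mono (λ X on → cong₂ _∧_ (∧-conicalˡ _ _ on) (S⊆T X (∧-conicalʳ (pointsOf l X) _ on))))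

  meet-∪-≤ : ∀ l S T → meet l (S ∪ T) ≤ meet l S + meet l T
  meet-∪-≤ l S T = subst₂ _≤_ (sym (trans (meet≡# l (S ∪ T)) (#-cong (λ X → ∧-distribˡ-∨ (pointsOf l X) (S X) (T X)))))
                              (sym (cong₂ _+_ (meet≡# l S) (meet≡# l T)))
                              (#-∪-≤ (pointsOf l ∩ S) (pointsOf l ∩ T))

  meet-⋃-≤ : ∀ {n} l (T : Fin n → PointSet) → meet l (⋃ T) ≤ sumFin (λ i → meet l (T i))
  meet-⋃-≤ l T = subst₂ _≤_ (sym (trans (meet≡# l (⋃ T)) (#-cong (∩-⋃ (pointsOf l) T))))
                            (sumFin-cong (λ i → sym (meet≡# l (T i))))
                            (#-⋃-≤ (λ i → pointsOf l ∩ T i))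

  meet-⋃ : ∀ {n} l (T : Fin n → PointSet) → Disjoint T → meet l (⋃ T) ≡ sumFin (λ i → meet l (T i))
  meet-⋃ l T disjoint =
    trans (meet≡# l (⋃ T))
          (trans (#-cong (∩-⋃ (pointsOf l) T))
                 (trans (#-⋃ (λ i → pointsOf l ∩ T i) (λ i j i≢j X on → trans (cong (pointsOf l X ∧_) (disjoint i j i≢j X (∧-conicalʳ (pointsOf l X) _ on)))
                                                                 (∧-zeroʳ (pointsOf l X))))
                        (sumFin-cong (λ i → sym (meet≡# l (T i))))))

  lines-meet-≤1 : ∀ {l n} → l ≢ n → meet l (pointsOf n) ≤ 1
  lines-meet-≤1 {l} {n} l≢n = subst (_≤ 1) (sym (meet≡# l (pointsOf n))) (#-≤1 _ λ X Y onX onY →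
    unique-meet l≢n (on-line⇒∈L {X} {l} (∧-conicalˡ _ _ onX)) (on-line⇒∈L {Y} {l} (∧-conicalˡ _ _ onY))
                    (on-line⇒∈L {X} {n} (∧-conicalʳ (pointsOf l X) _ onX)) (on-line⇒∈L {Y} {n} (∧-conicalʳ (pointsOf l Y) _ onY)))

  minus-spec : ∀ (T : PointSet) P X → (T minus P) X ≡ T X ∧ not (does (X ≟P P))
  minus-spec T ((x' , y' , z') , _) ((x , y , z) , _) with x ≟F x' | y ≟F y' | z ≟F z'
  ... | yes refl | yes refl | yes refl = refl
  ... | no  _    | _        | _        = refl
  ... | yes refl | no  _    | _        = refl
  ... | yes refl | yes refl | no  _    = refl

  minus-⊆ : ∀ T P → (T minus P) ⊆ T
  minus-⊆ T P X on = ∧-conicalˡ _ _ (trans (sym (minus-spec T P X)) on)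

  minus-point : ∀ T P → (T minus P) P ≡ false
  minus-point T P = trans (minus-spec T P P) (trans (cong (λ b → T P ∧ not b) (dec-true (P ≟P P) refl)) (∧-zeroʳ (T P)))

  #-line-minus-point : ∀ {P l} → P ∈L l → # (pointsOf l minus P) ≡ q
  #-line-minus-point {P} {l} Pl = +-cancelʳ-≡ 1 _ _ (begin
    # (pointsOf l minus P) + 1                   ≡⟨ cong (# (pointsOf l minus P) +_) (sym (∑P-δ P)) ⟩
    # (pointsOf l minus P) + ∑P (λ X → δP X P)   ≡⟨ sym (sumBy-+ (𝟙 ∘ (pointsOf l minus P)) (λ X → δP X P) allPoints) ⟩
    ∑P (λ X → 𝟙 ((pointsOf l minus P) X) + δP X P) ≡⟨ sym (sumBy-cong allPoints split) ⟩
    # (pointsOf l)                               ≡⟨ trans (points-on-line l) (+-comm 1 q) ⟩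
    q + 1                                        ∎)
    where
    open ≡-Reasoning
    split : ∀ X → 𝟙 (pointsOf l X) ≡ 𝟙 ((pointsOf l minus P) X) + δP X P
    split X = trans (𝟙-split (pointsOf l X) (does (X ≟P P)) (λ X≟P → subst (λ Y → pointsOf l Y ≡ true)
                                                                            (sym (does-true⇒ (X ≟P P) X≟P))
                                                                            (∈L⇒on-line {P} {l} Pl)))
                    (cong (λ b → 𝟙 b + δP X P) (sym (minus-spec (pointsOf l) P X)))

  line-minus-point-outside : ∀ {P l} (A : PointSet) → P ∈L l → P ∉ A →
                             # (λ X → not (A X) ∧ (pointsOf l minus P) X) + meet l A ≡ q
  line-minus-point-outside {P} {l} A Pl P∉A = begin
    # (λ X → not (A X) ∧ (pointsOf l minus P) X) + meet l A
      ≡⟨ cong (# (λ X → not (A X) ∧ (pointsOf l minus P) X) +_) (meet≡# l A) ⟩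
    # (λ X → not (A X) ∧ (pointsOf l minus P) X) + # (pointsOf l ∩ A)
      ≡⟨ sym (sumBy-+ (λ X → 𝟙 (not (A X) ∧ (pointsOf l minus P) X)) (𝟙 ∘ (pointsOf l ∩ A)) allPoints) ⟩
    ∑P (λ X → 𝟙 (not (A X) ∧ (pointsOf l minus P) X) + 𝟙 (pointsOf l X ∧ A X))
      ≡⟨ sym (sumBy-cong allPoints split) ⟩
    # (pointsOf l minus P)
      ≡⟨ #-line-minus-point {P} {l} Pl ⟩
    q ∎
    where
    open ≡-Reasoning
    split : ∀ X → 𝟙 ((pointsOf l minus P) X) ≡ 𝟙 (not (A X) ∧ (pointsOf l minus P) X) + 𝟙 (pointsOf l X ∧ A X)
    split X =
      trans (cong 𝟙 (minus-spec (pointsOf l) P X))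
            (trans (𝟙-partition (pointsOf l X) (does (X ≟P P)) (A X)
                                (λ X≟P → subst (λ Y → A Y ≡ false) (sym (does-true⇒ (X ≟P P) X≟P)) P∉A))
                   (cong (λ b → 𝟙 (not (A X) ∧ b) + 𝟙 (pointsOf l X ∧ A X)) (sym (minus-spec (pointsOf l) P X))))

module Configuration {q : ℕ} (F : FiniteField q) where

  open PG F
  open Incidence F
  open Counting F
  open PointSets F

  module Setting
    (m : ℕ) (q≡m² : q ≡ m * m) {s : ℕ} (s≤q∸m : s ≤ q ∸ m)
    (B : Fin s → PointSet) (baer : ∀ i → IsBaerSubplane m (B i)) (B-disjoint : Disjoint B)
    (P : Point) (P∉A : P ∉ ⋃ B)
    {r : ℕ} (ℓ : Fin r → Line) (ℓ-injective : Injective _≡_ _≡_ ℓ)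
    (Pℓ : ∀ i → P ∈L ℓ i) (ℓ-meets-A : ∀ i → meet (ℓ i) (⋃ B) ≡ s)
    (ℓ' : Line) (Pℓ' : P ∈L ℓ') (ℓ'≢ℓ : ∀ i → ℓ' ≢ ℓ i)
    (H : PointSet) (H⊆ℓ'∖A : ∀ R → R ∈ H → R ∈ pointsOf ℓ' × R ∉ ⋃ B)
    where

    A : PointSet
    A = ⋃ B

    Lᵢ : Fin r → PointSet
    Lᵢ i = pointsOf (ℓ i) minus P

    L : PointSet
    L = ⋃ Lᵢ

    S : PointSet
    S = (A ∪ L) ∪ H

    module Bᵢ (i : Fin s) = Subplanes F (proj₂ (baer i))

    on-Lᵢ : ∀ i X → Lᵢ i X ≡ true → X ∈L ℓ i × X ≢ P
    on-Lᵢ i X on = on-line⇒∈L {X} {ℓ i} (minus-⊆ (pointsOf (ℓ i)) P X on)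
                 , λ { refl → false≢true (trans (sym (minus-point (pointsOf (ℓ i)) P)) on) }

    Lᵢ-disjoint : Disjoint Lᵢ
    Lᵢ-disjoint i j i≢j X onᵢ with Lᵢ j X in onⱼ
    ... | false = refl
    ... | true  = let (Xℓᵢ , X≢P) = on-Lᵢ i X onᵢ ; (Xℓⱼ , _) = on-Lᵢ j X onⱼ
                  in ⊥-elim (i≢j (ℓ-injective (unique-line X≢P Xℓᵢ (Pℓ i) Xℓⱼ (Pℓ j))))

    L-off-ℓ' : ∀ X → X ∈L ℓ' → L X ≡ false
    L-off-ℓ' X Xℓ' with L X in onL
    ... | false = refl
    ... | true  = let (i , onᵢ) = anyFin-witness (λ i → Lᵢ i X) (trans (sym (⋃-anyFin Lᵢ X)) onL)
                      (Xℓᵢ , X≢P) = on-Lᵢ i X onᵢ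
                  in ⊥-elim (ℓ'≢ℓ i (unique-line X≢P Xℓ' Pℓ' Xℓᵢ (Pℓ i)))

    A-size : # A ≡ s * (q + m + 1)
    A-size = trans (#-⋃ B B-disjoint) (trans (sumFin-cong (λ i → trans (Bᵢ.size i) subplane-size)) (sumFin-const {s} (q + m + 1)))
      where
      tidy : ∀ m → suc (m * suc m) ≡ m * m + m + 1
      tidy = solve-∀
      subplane-size : suc (m * suc m) ≡ q + m + 1
      subplane-size = trans (tidy m) (cong (λ k → k + m + 1) (sym q≡m²))

    Lᵢ∖A : Fin r → PointSet
    Lᵢ∖A i X = not (A X) ∧ Lᵢ i X

    Lᵢ∖A-size : ∀ i → # (Lᵢ∖A i) ≡ q ∸ s
    Lᵢ∖A-size i = trans (sym (m+n∸n≡m _ s))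
                        (cong (_∸ s) (trans (cong (# (Lᵢ∖A i) +_) (sym (ℓ-meets-A i))) (line-minus-point-outside {P} {ℓ i} A (Pℓ i) P∉A)))

    Lᵢ∖A-disjoint : Disjoint Lᵢ∖A
    Lᵢ∖A-disjoint i j i≢j X on =
      trans (cong (not (A X) ∧_) (Lᵢ-disjoint i j i≢j X (∧-conicalʳ (not (A X)) _ on))) (∧-zeroʳ (not (A X)))

    𝟙-S : ∀ X → 𝟙 (S X) ≡ 𝟙 (A X) + 𝟙 (⋃ Lᵢ∖A X) + 𝟙 (H X)
    𝟙-S X = trans (𝟙-∨-disjoint (A X) (L X) (H X) H-apart)
                  (cong (λ b → 𝟙 (A X) + 𝟙 b + 𝟙 (H X))
                        (trans (cong (not (A X) ∧_) (⋃-anyFin Lᵢ X))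
                               (trans (∧-anyFin (not (A X)) (λ i → Lᵢ i X)) (sym (⋃-anyFin Lᵢ∖A X)))))
      where
      H-apart : H X ≡ true → A X ∨ L X ≡ false
      H-apart HX = let (Xℓ' , X∉A) = H⊆ℓ'∖A X HX in cong₂ _∨_ X∉A (L-off-ℓ' X (on-line⇒∈L {X} {ℓ'} Xℓ'))

    size : ∣ S ∣ ≡ s * (q + m + 1) + r * (q ∸ s) + ∣ H ∣
    size = begin
      ∣ S ∣                                             ≡⟨ trans (∣∣≡# S) (sumBy-cong allPoints 𝟙-S) ⟩
      ∑P (λ X → 𝟙 (A X) + 𝟙 (⋃ Lᵢ∖A X) + 𝟙 (H X))
        ≡⟨ trans (sumBy-+ (λ X → 𝟙 (A X) + 𝟙 (⋃ Lᵢ∖A X)) (𝟙 ∘ H) allPoints)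
                 (cong (_+ # H) (sumBy-+ (𝟙 ∘ A) (𝟙 ∘ ⋃ Lᵢ∖A) allPoints)) ⟩
      # A + # (⋃ Lᵢ∖A) + # H
        ≡⟨ cong₂ _+_ (cong₂ _+_ A-size (trans (#-⋃ Lᵢ∖A Lᵢ∖A-disjoint) (trans (sumFin-cong Lᵢ∖A-size) (sumFin-const {r} (q ∸ s)))))
                     (sym (∣∣≡# H)) ⟩
      s * (q + m + 1) + r * (q ∸ s) + ∣ H ∣               ∎
      where open ≡-Reasoning

    meet-ℓ' : meet ℓ' S ≡ meet ℓ' A + ∣ H ∣
    meet-ℓ' = trans (meet≡# ℓ' S)
                    (trans (sumBy-cong allPoints pointwise)
                           (trans (sumBy-+ (𝟙 ∘ (pointsOf ℓ' ∩ A)) (𝟙 ∘ H) allPoints)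
                                  (cong₂ _+_ (sym (meet≡# ℓ' A)) (sym (∣∣≡# H)))))
      where
      on-ℓ' : ∀ p a l h → (h ≡ true → p ≡ true × a ≡ false) → (p ≡ true → l ≡ false) →
              𝟙 (p ∧ ((a ∨ l) ∨ h)) ≡ 𝟙 (p ∧ a) + 𝟙 h
      on-ℓ' false a     l true  H⊆ _   = ⊥-elim (false≢true (proj₁ (H⊆ refl)))
      on-ℓ' false a     l false _  _   = refl
      on-ℓ' true  a     l h     H⊆ ℓ'⊥L with ℓ'⊥L refl
      on-ℓ' true  true  l true  H⊆ _ | refl = ⊥-elim (false≢true (sym (proj₂ (H⊆ refl))))
      on-ℓ' true  true  l false _  _ | refl = refl
      on-ℓ' true  false l h     _  _ | refl = refl
      pointwise : ∀ X → 𝟙 (pointsOf ℓ' X ∧ S X) ≡ 𝟙 (pointsOf ℓ' X ∧ A X) + 𝟙 (H X)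
      pointwise X = on-ℓ' (pointsOf ℓ' X) (A X) (L X) (H X) (H⊆ℓ'∖A X) (L-off-ℓ' X ∘ on-line⇒∈L {X} {ℓ'})

    s+m≤q : s + m ≤ q
    s+m≤q = ≤-trans (+-monoˡ-≤ m s≤q∸m) (≤-reflexive (m∸n+n≡m (subst (m ≤_) (sym q≡m²) (m≤m² m))))
      where
      m≤m² : ∀ m → m ≤ m * m
      m≤m² zero    = z≤n
      m≤m² (suc k) = m≤m*n (suc k) (suc k)

    A⊆S : A ⊆ S
    A⊆S X X∈A = cong (λ b → (b ∨ L X) ∨ H X) X∈A

    Lᵢ⊆S : ∀ i → Lᵢ i ⊆ S
    Lᵢ⊆S i X X∈Lᵢ = trans (cong (λ b → (A X ∨ b) ∨ H X) (trans (⋃-anyFin Lᵢ X) (anyFin-intro (λ j → Lᵢ j X) i X∈Lᵢ)))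
                          (cong (_∨ H X) (∨-zeroʳ (A X)))

    ℓᵢ-rich : ∀ i → q ≤ meet (ℓ i) S
    ℓᵢ-rich i = begin
      q                  ≡⟨ sym (#-line-minus-point {P} {ℓ i} (Pℓ i)) ⟩
      # (Lᵢ i)           ≤⟨ #-mono (λ X on → cong₂ _∧_ (minus-⊆ (pointsOf (ℓ i)) P X on) (Lᵢ⊆S i X on)) ⟩
      # (pointsOf (ℓ i) ∩ S) ≡⟨ sym (meet≡# (ℓ i) S) ⟩
      meet (ℓ i) S       ∎
      where open ≤-Reasoning

    secant-rich : ∀ n i → 2 ≤ meet n (B i) → s + m ≤ meet n S
    secant-rich n i two = begin
      s + m                                      ≡⟨ sym count ⟩
      sumFin (λ j → 1 + 𝟙 (does (j ≟F i)) * m)  ≤⟨ sumFin-mono pointwise ⟩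
      sumFin (λ j → meet n (B j))                ≡⟨ sym (meet-⋃ n B B-disjoint) ⟩
      meet n A                                   ≤⟨ meet-mono n A⊆S ⟩
      meet n S                                   ∎
      where
      open ≤-Reasoning
      count : sumFin (λ j → 1 + 𝟙 (does (j ≟F i)) * m) ≡ s + m
      count = trans (sumFin-+ (λ _ → 1) (λ j → 𝟙 (does (j ≟F i)) * m))
                    (cong₂ _+_ (trans (sumFin-const {s} 1) (*-identityʳ s)) (sumFin-δ i (λ _ → m)))
      pointwise : ∀ j → 1 + 𝟙 (does (j ≟F i)) * m ≤ meet n (B j)
      pointwise j with j ≟F i
      ... | yes refl = ≤-reflexive (trans (cong suc (+-identityʳ m))
                                          (sym (IsSubplane.order (proj₂ (baer i)) n (Bᵢ.two-points⇒subplane-line i n two))))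
      ... | no  _    = Bᵢ.baer-meets-every-line j q≡m² n

    tangent-poor : ∀ n → n ≢ ℓ' → (∀ i → n ≢ ℓ i) → (∀ i → meet n (B i) ≤ 1) → meet n S ≤ s + r + 1
    tangent-poor n n≢ℓ' n≢ℓ thin = begin
      meet n S                        ≤⟨ meet-∪-≤ n (A ∪ L) H ⟩
      meet n (A ∪ L) + meet n H       ≤⟨ +-monoˡ-≤ (meet n H) (meet-∪-≤ n A L) ⟩
      meet n A + meet n L + meet n H  ≤⟨ +-mono-≤ (+-mono-≤ on-A on-L) on-H ⟩
      s + r + 1                       ∎
      where
      open ≤-Reasoning
      on-A : meet n A ≤ s
      on-A = ≤-trans (meet-⋃-≤ n B) (≤-trans (sumFin-mono thin) (≤-reflexive (trans (sumFin-const {s} 1) (*-identityʳ s))))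
      on-L : meet n L ≤ r
      on-L = ≤-trans (meet-⋃-≤ n Lᵢ)
                     (≤-trans (sumFin-mono (λ i → ≤-trans (meet-mono n (minus-⊆ (pointsOf (ℓ i)) P)) (lines-meet-≤1 (n≢ℓ i))))
                              (≤-reflexive (trans (sumFin-const {r} 1) (*-identityʳ r))))
      on-H : meet n H ≤ 1
      on-H = ≤-trans (meet-mono n (λ X X∈H → proj₁ (H⊆ℓ'∖A X X∈H))) (lines-meet-≤1 n≢ℓ')

    meet-dichotomy : ∀ n → n ≢ ℓ' → meet n S ≤ s + r + 1 ⊎ s + m ≤ meet n S
    meet-dichotomy n n≢ℓ' with any? (λ i → n ≟P ℓ i)
    ... | yes (i , refl) = inj₂ (≤-trans s+m≤q (ℓᵢ-rich i))
    ... | no  n∉ℓ with any? (λ i → 2 ≤? meet n (B i))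
    ...   | yes (i , two) = inj₂ (secant-rich n i two)
    ...   | no  no-secant = inj₁ (tangent-poor n n≢ℓ' (λ i n≡ℓᵢ → n∉ℓ (i , n≡ℓᵢ))
                                                     (λ i → ≤-pred (≰⇒> (λ two → no-secant (i , two)))))

mainTheorem13 : (q m : ℕ) (F : FiniteField q) → q ≡ m * m →
    let open PG F in
    (s : ℕ) → 1 ≤ s → s ≤ q ∸ m →
    (B : Fin s → PointSet) → (∀ i → IsBaerSubplane m (B i)) →
    (∀ i j → i ≢ j → ∀ P → P ∈ B i → P ∉ B j) →
    (P : Point) → P ∉ ⋃ B →
    (r : ℕ) → r ≤ q ∸ s →
    (ℓ : Fin r → Line) → Injective _≡_ _≡_ ℓ →
    (∀ i → P ∈L ℓ i) → (∀ i → meet (ℓ i) (⋃ B) ≡ s) →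
    (ℓ' : Line) → P ∈L ℓ' → (∀ i → ℓ' ≢ ℓ i) →
    (H : PointSet) → (∀ R → R ∈ H → R ∈ pointsOf ℓ' × R ∉ ⋃ B) →
    (meet ℓ' (⋃ B) ≡ s × ∣ H ∣ ≤ q ∸ s)
      ⊎ (meet ℓ' (⋃ B) ≡ m + s × ∣ H ∣ ≤ q ∸ m ∸ s) →
    let S = (⋃ B ∪ ⋃ (λ i → pointsOf (ℓ i) minus P)) ∪ H in
    (∣ S ∣ ≡ s * (q + m + 1) + r * (q ∸ s) + ∣ H ∣)
    × (∀ ℓ'' → ℓ'' ≢ ℓ' → meet ℓ'' S ≤ s + r + 1 ⊎ s + m ≤ meet ℓ'' S)
    × (meet ℓ' (⋃ B) ≡ s → meet ℓ' S ≡ s + ∣ H ∣)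
    × (meet ℓ' (⋃ B) ≡ m + s → meet ℓ' S ≡ s + m + ∣ H ∣)
mainTheorem13 q m F q≡m² s _ s≤q∸m B baer B-disjoint P P∉A r _ ℓ ℓ-injective Pℓ ℓ-meets-A ℓ' Pℓ' ℓ'≢ℓ H H⊆ℓ'∖A _ =
  size , meet-dichotomy , (λ e → trans meet-ℓ' (cong (_+ ∣ H ∣) e))
                        , (λ e → trans meet-ℓ' (cong (_+ ∣ H ∣) (trans e (+-comm m s))))
  where
  open PG F
  open Configuration.Setting F m q≡m² s≤q∸m B baer B-disjoint P P∉A ℓ ℓ-injective Pℓ ℓ-meets-A ℓ' Pℓ' ℓ'≢ℓ H H⊆ℓ'∖A
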